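{- The $\mathsf{LTL}$ formula $\mathsf{F}\,p$ (equivalent to the $\mathsf{CTL}$ formula $\forall\mathsf{F}\,p$) cannot be expressed in either $\mathsf{HS}_{\mathsf{ct}}$ or $\mathsf{HS}_{\mathsf{st}}$: there is no $\mathsf{HS}$ formula $\psi$ such that for all finite Kripke structures $K$, $K\models_{\mathsf{st}}\psi\iff K\models\mathsf{F}\,p$, and no $\mathsf{HS}$ formula $\psi$ such that for all finite Kripke structures $K$, $K\models_{\mathsf{ct}}\psi\iff K\models\mathsf{F}\,p$.
   Context: A Kripke structure is $K=(\mathcal{AP},S,\delta,\mu,s_0)$ ($\mathcal{AP}$ finite, left-total $\delta\subseteq S\times S$, $\mu:S\to2^{\mathcal{AP}}$, initial $s_0$); finite if $S$ finite. Infinite paths and traces follow $\delta$, initial if they start at $s_0$; $\mathrm{lst}(\rho)$ is the last state of a trace. $K\models\mathsf{F}\,p$ iff every initial infinite path visits a state whose label contains $p$. $\mathsf{HS}$: $\psi::=p\mid\neg\psi\mid\psi\wedge\psi\mid\langle B\rangle\psi\mid\langle E\rangle\psi\mid\langle\overline{B}\rangle\psi\mid\langle\overline{E}\rangle\psi$ (other Halpern–Shoham modalities are abbreviations). State-based semantics on traces: $\rho\models p$ iff $p$ labels every state of $\rho$; $\langle B\rangle$/$\langle E\rangle$: some proper non-empty prefix/suffix satisfies the argument; $\langle\overline{B}\rangle$/$\langle\overline{E}\rangle$: some trace having $\rho$ as proper prefix/suffix satisfies it; $K\models_{\mathsf{st}}\psi$ iff all initial traces satisfy $\psi$. $C(K)$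 has states the initial traces of $K$, transitions $(\rho,\rho s)$ for $(\mathrm{lst}(\rho),s)\in\delta$, labels $\mu(\mathrm{lst}(\rho))$, initial state $s_0$; $K\models_{\mathsf{ct}}\psi$ iff $C(K)\models_{\mathsf{st}}\psi$. -}

module Defs where

open import Data.Nat using (ℕ; suc)
open import Data.Fin using (Fin)
open import Data.Fin.Subset using (Subset; _∈_)
open import Data.List.NonEmpty using (List⁺; toList; head; last; [_]; _⁺++⁺_; _⁺∷ʳ_)
open import Data.List.Relation.Unary.All using (All)
open import Data.List.Relation.Unary.Linked using (Linked; [-])
open import Data.Product using (Σ; ∃; _×_; _,_; proj₁)
open import Relation.Binary.PropositionalEquality using (_≡_; refl)
open import Relation.Nullary using (¬_)

-- Kripke structure over AP = Fin n with state set S.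
-- Left-totality is stated separately (LeftTotal) so that C(K) can be
-- built without proof obligations.
record Kripke (n : ℕ) (S : Set) : Set₁ where
  field
    δ  : S → S → Set
    μ  : S → Subset n
    s₀ : S
open Kripke public

LeftTotal : ∀ {n S} → Kripke n S → Set
LeftTotal K = ∀ s → ∃ λ s' → δ K s s'

IsTrace : ∀ {n S} → Kripke n S → List⁺ S → Set
IsTrace K ρ = Linked (δ K) (toList ρ)

data HS (n : ℕ) : Set where
  prop : Fin n → HS n
  ¬ₕ_  : HS n → HS n
  _∧ₕ_ : HS n → HS n → HS n
  ⟨B⟩  : HS n → HS n
  ⟨E⟩  : HS n → HS n
  ⟨B̅⟩  : HS n → HS n
  ⟨E̅⟩  : HS n → HS n

Sat : ∀ {n S} → Kripke n S → List⁺ S → HS n → Set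
Sat K ρ (prop q)  = All (λ s → q ∈ μ K s) (toList ρ)
Sat K ρ (¬ₕ ψ)    = ¬ Sat K ρ ψ
Sat K ρ (ψ ∧ₕ φ)  = Sat K ρ ψ × Sat K ρ φ
Sat K ρ (⟨B⟩ ψ)   = Σ (List⁺ _) λ ρ′ → Σ (List⁺ _) λ ρ″ → (ρ ≡ ρ′ ⁺++⁺ ρ″) × Sat K ρ′ ψ
Sat K ρ (⟨E⟩ ψ)   = Σ (List⁺ _) λ ρ′ → Σ (List⁺ _) λ ρ″ → (ρ ≡ ρ″ ⁺++⁺ ρ′) × Sat K ρ′ ψ
Sat K ρ (⟨B̅⟩ ψ)   = Σ (List⁺ _) λ ρ″ → IsTrace K (ρ ⁺++⁺ ρ″) × Sat K (ρ ⁺++⁺ ρ″) ψ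
Sat K ρ (⟨E̅⟩ ψ)   = Σ (List⁺ _) λ ρ″ → IsTrace K (ρ″ ⁺++⁺ ρ) × Sat K (ρ″ ⁺++⁺ ρ) ψ

IsInitialTrace : ∀ {n S} → Kripke n S → List⁺ S → Set
IsInitialTrace K ρ = IsTrace K ρ × (head ρ ≡ s₀ K)

_⊨st_ : ∀ {n S} → Kripke n S → HS n → Set
K ⊨st ψ = ∀ ρ → IsInitialTrace K ρ → Sat K ρ ψ

CState : ∀ {n S} → Kripke n S → Set
CState {S = S} K = Σ (List⁺ S) (IsInitialTrace K)

C : ∀ {n S} (K : Kripke n S) → Kripke n (CState K)
C {S = S} K = record
  { δ  = λ ρ ρ′ → Σ S λ s → δ K (last (proj₁ ρ)) s × (proj₁ ρ′ ≡ proj₁ ρ ⁺∷ʳ s)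
  ; μ  = λ ρ → μ K (last (proj₁ ρ))
  ; s₀ = [ s₀ K ] , [-] , refl
  }

_⊨ct_ : ∀ {n S} → Kripke n S → HS n → Set
K ⊨ct ψ = C K ⊨st ψ

IsInitialPath : ∀ {n S} → Kripke n S → (ℕ → S) → Set
IsInitialPath K π = (π 0 ≡ s₀ K) × (∀ i → δ K (π i) (π (suc i)))

_⊨F_ : ∀ {n S} → Kripke n S → Fin n → Set
K ⊨F p = ∀ π → IsInitialPath K π → ∃ λ i → p ∈ μ K (π i)

-- For every modal depth h take the ladder with heights 0 … M, M = 2·threshold h + 1 and
-- threshold h = 2^(h+1): every step goes down by one, 0 and M carry self-loops, and p holds only
-- at 0. Started at the top M it has the path that stays at M, so F p fails; started at M − 1
-- every path reaches 0, so F p holds. A trace of the ladder is described by the length and the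
-- last height of its descending part and by its number of trailing zeros, and two traces whose
-- descriptions agree up to "both at least threshold h" satisfy the same HS formulas of depth h:
-- in the Ehrenfeucht–Fraïssé game each move halves the threshold. Every initial trace from the
-- top has such a partner among the initial traces from M − 1, so no formula of depth h separates
-- the two structures. For the computation-tree semantics the same game is played on traces of
-- the ladder together with the offset at which a trace of C(K) starts.

module Submission where

open import Defs
open import Data.Empty using (⊥; ⊥-elim)
open import Data.Fin as F using (Fin; toℕ)
open import Data.Fin.Properties using (toℕ≤pred[n]; toℕ-inject₁; toℕ-injective)
open import Data.Fin.Subset as Subset using (Subset; _∈_)
open import Data.Fin.Subset.Properties using (∈⊤; ∉⊥)
open import Data.List as L using (List; []; _∷_; _++_; replicate; length; drop)
open import Data.List.Properties
  using (map-++; length-map; length-++; drop-map; ++-assoc; ∷ʳ-injective; ∷-injective; ∷-injectiveˡ; ++-identityʳ; length-replicate)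
open import Data.List.NonEmpty as N using (List⁺; _∷_; toList; _⁺++⁺_; _∷⁺_; last; snocView; _∷ʳ′_; _∷ʳ_; _⁺∷ʳ_; _⁺++_; [_])
open import Data.List.Relation.Unary.All using (All; []; _∷_)
import Data.List.Relation.Unary.All.Properties as AP
open import Data.List.Relation.Unary.Linked using (Linked; []; [-]; _∷_)
open import Data.List.Relation.Unary.Linked.Properties using (map⁺; map⁻)
open import Data.Nat
open import Data.Nat.Properties
open import Data.Product using (Σ; _×_; _,_; proj₁; proj₂)
open import Data.Sum using (_⊎_; inj₁; inj₂)
open import Data.Product.Function.NonDependent.Propositional using (_×-⇔_)
open import Function.Bundles using (_⇔_; mk⇔; Equivalence)
open import Function.Construct.Composition using (_⇔-∘_)
open import Function.Construct.Identity using (⇔-id)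
open import Function.Related.TypeIsomorphisms using (¬-cong-⇔)
open import Relation.Binary.PropositionalEquality hiding ([_])
open import Relation.Nullary using (yes; no; ¬_)

open Equivalence using (to; from)

≤⇒≡+ : ∀ {k m} → k ≤ m → Σ ℕ λ r → m ≡ k + r
≤⇒≡+ {k} {m} k≤m = m ∸ k , sym (m+[n∸m]≡n k≤m)

<⇒≡+suc : ∀ {k m} → k < m → Σ ℕ λ r → m ≡ k + suc r
<⇒≡+suc {k} {m} k<m = m ∸ suc k , trans (sym (m+[n∸m]≡n k<m)) (sym (+-suc k (m ∸ suc k)))

m<m+n⇒0<n : ∀ k x → k < k + x → 1 ≤ x
m<m+n⇒0<n k zero h = ⊥-elim (<-irrefl (sym (+-identityʳ k)) h)
m<m+n⇒0<n k (suc x) h = s≤s z≤n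

a+c≡s+[b+1+c]⇒a≡1+s+b : ∀ a b c s → a + c ≡ s + (b + suc c) → a ≡ suc (s + b)
a+c≡s+[b+1+c]⇒a≡1+s+b a b c s e =
  +-cancelʳ-≡ c a (suc (s + b)) (trans e (trans (cong (s +_) (+-suc b c)) (trans (+-suc s (b + c)) (cong suc (sym (+-assoc s b c))))))

1+a+[b+1+c]≡1+s+c⇒a<s : ∀ a b c s → suc a + (b + suc c) ≡ suc s + c → a < s
1+a+[b+1+c]≡1+s+c⇒a<s a b c s e = ≤-trans (s≤s (m≤m+n a b)) (≤-reflexive (suc-injective (+-cancelʳ-≡ c (suc (suc (a + b))) (suc s) (trans (sym rearranged) e))))
  where
  rearranged : suc a + (b + suc c) ≡ suc (suc (a + b)) + c
  rearranged = cong suc (trans (cong (a +_) (+-suc b c)) (trans (+-suc a (b + c)) (cong suc (sym (+-assoc a b c)))))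

module _ {A : Set} where

  ++-injective : (xs ys us vs : List A) → xs ++ ys ≡ us ++ vs → length xs ≡ length us → xs ≡ us × ys ≡ vs
  ++-injective [] ys [] vs e _ = refl , e
  ++-injective (x ∷ xs) ys (u ∷ us) vs e l with ∷-injective e
  ... | refl , e' with ++-injective xs ys us vs e' (cong pred l)
  ... | refl , refl = refl , refl

  replicate-+ : ∀ i d (a : A) → replicate (i + d) a ≡ replicate i a ++ replicate d a
  replicate-+ zero d a = refl
  replicate-+ (suc i) d a = cong (a ∷_) (replicate-+ i d a)

  drop-length-++ : (xs ys : List A) → drop (length xs) (xs ++ ys) ≡ ys
  drop-length-++ [] ys = refl
  drop-length-++ (x ∷ xs) ys = drop-length-++ xs ys

  1≤length⁺ : (ρ : List⁺ A) → 1 ≤ length (toList ρ)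
  1≤length⁺ (x ∷ xs) = s≤s z≤n

  nonEmpty⇒List⁺ : (xs : List A) → 1 ≤ length xs → Σ (List⁺ A) λ l → toList l ≡ xs
  nonEmpty⇒List⁺ (x ∷ xs) _ = (x ∷ xs) , refl

  splitAt⁺ : (σ : List⁺ A) (k : ℕ) → 1 ≤ k → k < length (toList σ) →
             Σ (List⁺ A) λ σ1 → Σ (List⁺ A) λ σ2 → (σ ≡ σ1 ⁺++⁺ σ2) × (length (toList σ1) ≡ k)
  splitAt⁺ (x ∷ []) (suc k) _ (s≤s ())
  splitAt⁺ (x ∷ y ∷ xs) (suc zero) _ _ = (x ∷ []) , (y ∷ xs) , refl , refl
  splitAt⁺ (x ∷ y ∷ xs) (suc (suc k)) _ (s≤s lt) with splitAt⁺ (y ∷ xs) (suc k) (s≤s z≤n) lt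
  ... | (a ∷ as) , (b ∷ bs) , e , l = (x ∷ a ∷ as) , (b ∷ bs) , cong (x ∷⁺_) e , cong suc l

  toList≡init∷ʳlast : (l : List⁺ A) → Σ (List A) λ ys → toList l ≡ ys L.∷ʳ last l
  toList≡init∷ʳlast l with snocView l
  ... | [] ∷ʳ′ y = [] , refl
  ... | (x ∷ ys) ∷ʳ′ y = (x ∷ ys) , refl

  toList-∷ʳ : (xs : List A) (x : A) → toList (xs ∷ʳ x) ≡ xs L.∷ʳ x
  toList-∷ʳ [] x = refl
  toList-∷ʳ (y ∷ ys) x = refl

  last-∷ʳ : (xs : List A) (x : A) → last (xs ∷ʳ x) ≡ x
  last-∷ʳ xs x with toList≡init∷ʳlast (xs ∷ʳ x)
  ... | ys , eq = sym (proj₂ (∷ʳ-injective xs ys (trans (sym (toList-∷ʳ xs x)) eq)))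

  toList-injective : {a b : List⁺ A} → toList a ≡ toList b → a ≡ b
  toList-injective {a = x ∷ xs} {y ∷ ys} e with ∷-injective e
  ... | refl , refl = refl

  module _ {R : A → A → Set} where

    Linked-++⁻ˡ : (xs : List A) {ys : List A} → Linked R (xs ++ ys) → Linked R xs
    Linked-++⁻ˡ [] _ = []
    Linked-++⁻ˡ (x ∷ []) _ = [-]
    Linked-++⁻ˡ (x ∷ y ∷ xs) (r ∷ lk) = r ∷ Linked-++⁻ˡ (y ∷ xs) lk

    Linked-++⁻ʳ : (xs : List A) {ys : List A} → Linked R (xs ++ ys) → Linked R ys
    Linked-++⁻ʳ [] lk = lk
    Linked-++⁻ʳ (x ∷ []) {[]} _ = []
    Linked-++⁻ʳ (x ∷ []) {y ∷ ys} (_ ∷ lk) = lk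
    Linked-++⁻ʳ (x ∷ y ∷ xs) (_ ∷ lk) = Linked-++⁻ʳ (y ∷ xs) lk

    Linked-glue : (xs : List A) {y : A} {zs : List A} → Linked R (xs L.∷ʳ y) → Linked R (y ∷ zs) → Linked R (xs ++ y ∷ zs)
    Linked-glue [] _ lk = lk
    Linked-glue (x ∷ []) (r ∷ _) lk = r ∷ lk
    Linked-glue (x ∷ x' ∷ xs) (r ∷ lk1) lk = r ∷ Linked-glue (x' ∷ xs) lk1 lk

    Linked-∷ʳ : (xs : List A) {y x : A} → Linked R (xs L.∷ʳ y) → R y x → Linked R ((xs L.∷ʳ y) L.∷ʳ x)
    Linked-∷ʳ xs lk r = subst (Linked R) (sym (++-assoc xs _ _)) (Linked-glue xs lk (r ∷ [-]))

record IntervalStructure (n : ℕ) : Set₁ where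
  field
    Interval : Set
    Holds : Fin n → Interval → Set
    Prefix Suffix RightExt LeftExt : Interval → Interval → Set
open IntervalStructure

ISat : ∀ {n} (I : IntervalStructure n) → Interval I → HS n → Set
ISat I τ (prop q) = Holds I q τ
ISat I τ (¬ₕ ψ) = ¬ ISat I τ ψ
ISat I τ (ψ ∧ₕ φ) = ISat I τ ψ × ISat I τ φ
ISat I τ (⟨B⟩ ψ) = Σ (Interval I) λ τ' → Prefix I τ τ' × ISat I τ' ψ
ISat I τ (⟨E⟩ ψ) = Σ (Interval I) λ τ' → Suffix I τ τ' × ISat I τ' ψ
ISat I τ (⟨B̅⟩ ψ) = Σ (Interval I) λ τ' → RightExt I τ τ' × ISat I τ' ψ
ISat I τ (⟨E̅⟩ ψ) = Σ (Interval I) λ τ' → LeftExt I τ τ' × ISat I τ' ψ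

modalDepth : ∀ {n} → HS n → ℕ
modalDepth (prop _) = 0
modalDepth (¬ₕ ψ) = modalDepth ψ
modalDepth (ψ ∧ₕ φ) = modalDepth ψ ⊔ modalDepth φ
modalDepth (⟨B⟩ ψ) = suc (modalDepth ψ)
modalDepth (⟨E⟩ ψ) = suc (modalDepth ψ)
modalDepth (⟨B̅⟩ ψ) = suc (modalDepth ψ)
modalDepth (⟨E̅⟩ ψ) = suc (modalDepth ψ)

module _ {n} (I J : IntervalStructure n) where

  Forth Back : (Interval I → Interval I → Set) → (Interval J → Interval J → Set) →
               (Interval I → Interval J → Set) → (Interval I → Interval J → Set) → Set
  Forth P Q R R' = ∀ {x y x'} → R x y → P x x' → Σ (Interval J) λ y' → Q y y' × R' x' y'
  Back P Q R R' = ∀ {x y y'} → R x y → Q y y' → Σ (Interval I) λ x' → P x x' × R' x' y'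

  record GradedBisimulation : Set₁ where
    field
      Related : ℕ → Interval I → Interval J → Set
      holds : ∀ {h x y} → Related h x y → ∀ q → Holds I q x ⇔ Holds J q y
      prefix-forth : ∀ {h} → Forth (Prefix I) (Prefix J) (Related (suc h)) (Related h)
      prefix-back : ∀ {h} → Back (Prefix I) (Prefix J) (Related (suc h)) (Related h)
      suffix-forth : ∀ {h} → Forth (Suffix I) (Suffix J) (Related (suc h)) (Related h)
      suffix-back : ∀ {h} → Back (Suffix I) (Suffix J) (Related (suc h)) (Related h)
      rightExt-forth : ∀ {h} → Forth (RightExt I) (RightExt J) (Related (suc h)) (Related h)
      rightExt-back : ∀ {h} → Back (RightExt I) (RightExt J) (Related (suc h)) (Related h)
      leftExt-forth : ∀ {h} → Forth (LeftExt I) (LeftExt J) (Related (suc h)) (Related h)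
      leftExt-back : ∀ {h} → Back (LeftExt I) (LeftExt J) (Related (suc h)) (Related h)

module _ {n} {I J : IntervalStructure n} (Bi : GradedBisimulation I J) where
  open GradedBisimulation Bi

  private
    diamond-cong : ∀ {h} {P Q} → Forth I J P Q (Related (suc h)) (Related h) →
                   Back I J P Q (Related (suc h)) (Related h) →
                   {φ : Interval I → Set} {ψ : Interval J → Set} →
                   (∀ {x y} → Related h x y → φ x ⇔ ψ y) →
                   ∀ {x y} → Related (suc h) x y →
                   (Σ (Interval I) λ x' → P x x' × φ x') ⇔ (Σ (Interval J) λ y' → Q y y' × ψ y')
    diamond-cong forth back φ⇔ψ r = mk⇔
      (λ (x' , p , s) → let (y' , q , r') = forth r p in y' , q , to (φ⇔ψ r') s)
      (λ (y' , q , s) → let (x' , p , r') = back r q in x' , p , from (φ⇔ψ r') s)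

  Related⇒ISat⇔ : ∀ ψ h {x y} → modalDepth ψ ≤ h → Related h x y → ISat I x ψ ⇔ ISat J y ψ
  Related⇒ISat⇔ (prop q) h d r = holds r q
  Related⇒ISat⇔ (¬ₕ ψ) h d r = ¬-cong-⇔ (Related⇒ISat⇔ ψ h d r)
  Related⇒ISat⇔ (ψ ∧ₕ φ) h d r =
    Related⇒ISat⇔ ψ h (m⊔n≤o⇒m≤o (modalDepth ψ) (modalDepth φ) d) r
    ×-⇔ Related⇒ISat⇔ φ h (m⊔n≤o⇒n≤o (modalDepth ψ) (modalDepth φ) d) r
  Related⇒ISat⇔ (⟨B⟩ ψ) (suc h) (s≤s d) r = diamond-cong prefix-forth prefix-back (Related⇒ISat⇔ ψ h d) r
  Related⇒ISat⇔ (⟨E⟩ ψ) (suc h) (s≤s d) r = diamond-cong suffix-forth suffix-back (Related⇒ISat⇔ ψ h d) r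
  Related⇒ISat⇔ (⟨B̅⟩ ψ) (suc h) (s≤s d) r = diamond-cong rightExt-forth rightExt-back (Related⇒ISat⇔ ψ h d) r
  Related⇒ISat⇔ (⟨E̅⟩ ψ) (suc h) (s≤s d) r = diamond-cong leftExt-forth leftExt-back (Related⇒ISat⇔ ψ h d) r

-- For a family of structures and a symmetric relation the back conditions are the forth
-- conditions read from the other side.
module _ {n} {A : Set} (I : A → IntervalStructure n)
         (Related : ∀ {a b} → ℕ → Interval (I a) → Interval (I b) → Set)
         (Related-sym : ∀ {a b h x y} → Related {a} {b} h x y → Related {b} {a} h y x)
         (holds : ∀ {a b h x y} → Related {a} {b} h x y → ∀ q → Holds (I a) q x → Holds (I b) q y)
         (prefix-forth : ∀ {a b h} → Forth (I a) (I b) (Prefix (I a)) (Prefix (I b)) (Related (suc h)) (Related h))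
         (suffix-forth : ∀ {a b h} → Forth (I a) (I b) (Suffix (I a)) (Suffix (I b)) (Related (suc h)) (Related h))
         (rightExt-forth : ∀ {a b h} → Forth (I a) (I b) (RightExt (I a)) (RightExt (I b)) (Related (suc h)) (Related h))
         (leftExt-forth : ∀ {a b h} → Forth (I a) (I b) (LeftExt (I a)) (LeftExt (I b)) (Related (suc h)) (Related h))
         where

  private
    back : ∀ {a b h} {P : ∀ {c} → Interval (I c) → Interval (I c) → Set} →
           (∀ {a b} → Forth (I a) (I b) P P (Related (suc h)) (Related h)) →
           Back (I a) (I b) P P (Related {a} {b} (suc h)) (Related h)
    back forth r q = let (x' , p , r') = forth (Related-sym r) q in x' , p , Related-sym r'

  symmetricBisimulation : ∀ a b → GradedBisimulation (I a) (I b)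
  symmetricBisimulation a b = record
    { Related = Related
    ; holds = λ r q → mk⇔ (holds r q) (holds (Related-sym r) q)
    ; prefix-forth = prefix-forth
    ; prefix-back = back {P = Prefix (I _)} prefix-forth
    ; suffix-forth = suffix-forth
    ; suffix-back = back {P = Suffix (I _)} suffix-forth
    ; rightExt-forth = rightExt-forth
    ; rightExt-back = back {P = RightExt (I _)} rightExt-forth
    ; leftExt-forth = leftExt-forth
    ; leftExt-back = back {P = LeftExt (I _)} leftExt-forth
    }

traceStructure : ∀ {n S} → Kripke n S → IntervalStructure n
traceStructure {S = S} K = record
  { Interval = List⁺ S
  ; Holds = λ q ρ → All (λ s → q ∈ μ K s) (toList ρ)
  ; Prefix = λ ρ ρ' → Σ (List⁺ S) λ ρ'' → ρ ≡ ρ' ⁺++⁺ ρ''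
  ; Suffix = λ ρ ρ' → Σ (List⁺ S) λ ρ'' → ρ ≡ ρ'' ⁺++⁺ ρ'
  ; RightExt = λ ρ ρ' → Σ (List⁺ S) λ ρ'' → IsTrace K (ρ ⁺++⁺ ρ'') × ρ' ≡ ρ ⁺++⁺ ρ''
  ; LeftExt = λ ρ ρ' → Σ (List⁺ S) λ ρ'' → IsTrace K (ρ'' ⁺++⁺ ρ) × ρ' ≡ ρ'' ⁺++⁺ ρ
  }

Sat⇔ISat : ∀ {n S} (K : Kripke n S) ψ ρ → Sat K ρ ψ ⇔ ISat (traceStructure K) ρ ψ
Sat⇔ISat K (prop q) ρ = ⇔-id _
Sat⇔ISat K (¬ₕ ψ) ρ = ¬-cong-⇔ (Sat⇔ISat K ψ ρ)
Sat⇔ISat K (ψ ∧ₕ φ) ρ = Sat⇔ISat K ψ ρ ×-⇔ Sat⇔ISat K φ ρ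
Sat⇔ISat K (⟨B⟩ ψ) ρ = mk⇔ (λ (ρ' , ρ'' , e , s) → ρ' , (ρ'' , e) , to (Sat⇔ISat K ψ ρ') s)
                            (λ (ρ' , (ρ'' , e) , s) → ρ' , ρ'' , e , from (Sat⇔ISat K ψ ρ') s)
Sat⇔ISat K (⟨E⟩ ψ) ρ = mk⇔ (λ (ρ' , ρ'' , e , s) → ρ' , (ρ'' , e) , to (Sat⇔ISat K ψ ρ') s)
                            (λ (ρ' , (ρ'' , e) , s) → ρ' , ρ'' , e , from (Sat⇔ISat K ψ ρ') s)
Sat⇔ISat K (⟨B̅⟩ ψ) ρ = mk⇔ (λ (ρ'' , t , s) → _ , (ρ'' , t , refl) , to (Sat⇔ISat K ψ _) s)
                            (λ { (_ , (ρ'' , t , refl) , s) → ρ'' , t , from (Sat⇔ISat K ψ _) s })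
Sat⇔ISat K (⟨E̅⟩ ψ) ρ = mk⇔ (λ (ρ'' , t , s) → _ , (ρ'' , t , refl) , to (Sat⇔ISat K ψ _) s)
                            (λ { (_ , (ρ'' , t , refl) , s) → ρ'' , t , from (Sat⇔ISat K ψ _) s })

module ComputationTree {n : ℕ} {S : Set} (K : Kripke n S) where
  Node : Set
  Node = CState K
  Edge : Node → Node → Set
  Edge = δ (C K)
  lastState : Node → S
  lastState nd = last (proj₁ nd)
  path : Node → List S
  path nd = toList (proj₁ nd)
  spell : Node → List Node → List S
  spell nd ns = path nd ++ L.map lastState ns

  path-step : ∀ {nd nd'} → Edge nd nd' → path nd' ≡ path nd ++ lastState nd' ∷ []
  path-step {nd} {nd'} (x , d , eq) rewrite eq = trans (toList-∷ʳ (path nd) x) (cong (λ z → path nd ++ z ∷ []) (sym (last-∷ʳ (path nd) x)))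

  spell-step : ∀ {nd nd1} rest → Edge nd nd1 → spell nd (nd1 ∷ rest) ≡ spell nd1 rest
  spell-step {nd} {nd1} rest d = trans (sym (++-assoc (path nd) (lastState nd1 ∷ []) _)) (cong (_++ L.map lastState rest) (sym (path-step {nd} {nd1} d)))

  spell-from : ∀ nd ns m ms → Linked Edge (nd ∷ ns ++ m ∷ ms) → spell nd (ns ++ m ∷ ms) ≡ spell m ms
  spell-from nd [] m ms (d ∷ _) = spell-step {nd} {m} ms d
  spell-from nd (n1 ∷ ns) m ms (d ∷ lk) = trans (spell-step {nd} {n1} (ns ++ m ∷ ms) d) (spell-from n1 ns m ms lk)

  length-spell : ∀ nd ns → length (spell nd ns) ≡ length (path nd) + length ns
  length-spell nd ns = trans (length-++ (path nd)) (cong (length (path nd) +_) (length-map lastState ns))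

  spell-isTrace : ∀ nd ns → Linked Edge (nd ∷ ns) → Linked (δ K) (spell nd ns)
  spell-isTrace nd [] _ = subst (Linked (δ K)) (sym (++-identityʳ _)) (proj₁ (proj₂ nd))
  spell-isTrace nd (n1 ∷ ns) (d ∷ lk) = subst (Linked (δ K)) (sym (spell-step {nd} {n1} ns d)) (spell-isTrace n1 ns lk)

  drop-spell : ∀ nd ns s → length (path nd) ≡ suc s → drop s (spell nd ns) ≡ lastState nd ∷ L.map lastState ns
  drop-spell nd ns s l with toList≡init∷ʳlast (proj₁ nd)
  ... | ys , e = trans (cong (λ z → drop s (z ++ L.map lastState ns)) e)
                  (trans (cong (drop s) (++-assoc ys (lastState nd ∷ []) _))
                   (subst (λ k → drop k (ys ++ lastState nd ∷ L.map lastState ns) ≡ lastState nd ∷ L.map lastState ns) ly (drop-length-++ ys _)))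
    where
    ly : length ys ≡ s
    ly = suc-injective (trans (trans (sym (+-comm (length ys) 1)) (sym (length-++ ys))) (trans (cong length (sym e)) l))

  parent : (nd : Node) → 2 ≤ length (path nd) → Σ Node λ n0 → Edge n0 nd × (suc (length (path n0)) ≡ length (path nd))
  parent nd l2 with toList≡init∷ʳlast (proj₁ nd) | proj₁ (proj₂ nd) | proj₂ (proj₂ nd)
  ... | [] , e | _ | _ = ⊥-elim (<-irrefl refl (≤-trans l2 (≤-reflexive (cong length e))))
  ... | (y ∷ ys') , e | tr | hd with toList≡init∷ʳlast (y ∷ ys')
  ...   | zs , e2 = n0 , (lastState nd , dd , toList-injective (trans e (sym (toList-∷ʳ (y ∷ ys') (lastState nd))))) ,
                    sym (trans (cong length e) (trans (length-++ (y ∷ ys')) (+-comm _ 1)))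
    where
    tr' : Linked (δ K) ((y ∷ ys') ++ lastState nd ∷ [])
    tr' = subst (Linked (δ K)) e tr
    n0 : Node
    n0 = (y ∷ ys') , Linked-++⁻ˡ (y ∷ ys') tr' , trans (sym (proj₁ (∷-injective e))) hd
    dd : δ K (last (y ∷ ys')) (lastState nd)
    dd with Linked-++⁻ʳ zs (subst (Linked (δ K)) (trans (cong (_++ lastState nd ∷ []) e2) (++-assoc zs _ _)) tr')
    ... | r ∷ _ = r

  ancestors : ∀ k (nd : Node) → suc k < length (path nd) → Σ (List⁺ Node) λ ρ'' →
           (∀ rest → Linked Edge (nd ∷ rest) → Linked Edge (toList ρ'' ++ nd ∷ rest)) × (length (toList ρ'') ≡ suc k) ×
           (length (path (N.head ρ'')) + suc k ≡ length (path nd))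
  ancestors zero nd lt with parent nd lt
  ... | n0 , d , l = [ n0 ] , (λ rest lk → d ∷ lk) , refl , trans (+-comm _ 1) l
  ancestors (suc k) nd lt with parent nd (≤-trans (s≤s (s≤s z≤n)) lt)
  ... | n0 , d , l with ancestors k n0 (≤-pred (≤-trans lt (≤-reflexive (sym l))))
  ...   | ρ0 , lk0 , l0 , h0 = ρ0 ⁺++⁺ [ n0 ] ,
          (λ rest lk → subst (Linked Edge) (sym (++-assoc (toList ρ0) (n0 ∷ []) (nd ∷ rest))) (lk0 (nd ∷ rest) (d ∷ lk))) ,
          trans (length-++ (toList ρ0)) (trans (cong (_+ 1) l0) (+-comm (suc k) 1)) ,
          trans (+-suc (length (path (N.head ρ0))) (suc k)) (trans (cong suc h0) l)

  IsTrace-⁺∷ʳ : ∀ (P : List⁺ S) x → IsTrace K P → δ K (last P) x → IsTrace K (P ⁺∷ʳ x)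
  IsTrace-⁺∷ʳ P x tr d with toList≡init∷ʳlast P
  ... | ys , e = subst (Linked (δ K)) (sym (trans (toList-∷ʳ (toList P) x) (cong (L._∷ʳ x) e))) (Linked-∷ʳ ys (subst (Linked (δ K)) e tr) d)

  descendants : (nd : Node) (xs : List S) → Linked (δ K) (lastState nd ∷ xs) → Σ (List Node) λ ns → Linked Edge (nd ∷ ns) × (L.map lastState ns ≡ xs)
  descendants nd [] _ = [] , [-] , refl
  descendants nd (x ∷ xs) (d ∷ lk) with descendants (proj₁ nd ⁺∷ʳ x , IsTrace-⁺∷ʳ (proj₁ nd) x (proj₁ (proj₂ nd)) d , proj₂ (proj₂ nd)) xs
                                    (subst (λ z → Linked (δ K) (z ∷ xs)) (sym (last-∷ʳ (path nd) x)) lk)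
  ... | ns , lk' , e = _ ∷ ns , (x , d , refl) ∷ lk' , cong₂ _∷_ (last-∷ʳ (path nd) x) e

  -- A trace of C(K) is determined by the path Q of its last node and the offset s at which it
  -- starts: its nodes are the prefixes of Q of lengths s + 1, …, |Q|.
  Spells : List⁺ Node → List⁺ S × ℕ → Set
  Spells ρ (Q , s) = Linked Edge (toList ρ) × (toList Q ≡ spell (N.head ρ) (N.tail ρ)) × (length (path (N.head ρ)) ≡ suc s)

  spell-++ : ∀ nd xs ys → spell nd (xs ++ ys) ≡ spell nd xs ++ L.map lastState ys
  spell-++ nd xs ys = trans (cong (path nd ++_) (map-++ lastState xs ys)) (sym (++-assoc (path nd) _ _))

  length-window : ∀ {ρ Q s} → Spells ρ (Q , s) → length (toList Q) ≡ s + length (toList ρ)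
  length-window {ρ} {Q} {s} (lk , eQ , l) =
    trans (cong length eQ) (trans (length-spell (N.head ρ) (N.tail ρ)) (trans (cong (_+ length (N.tail ρ)) l) (sym (+-suc s _))))

  spell-last : ∀ (ρ : List⁺ Node) → Linked Edge (toList ρ) → spell (N.head ρ) (N.tail ρ) ≡ path (last ρ)
  spell-last ρ lk with toList≡init∷ʳlast ρ
  ... | [] , e with ∷-injective e
  ...   | e1 , e2 = trans (cong₂ spell e1 e2) (++-identityʳ _)
  spell-last ρ lk | (n0 ∷ ns) , e with ∷-injective e
  ...   | e1 , e2 = trans (cong₂ spell e1 e2) (trans (spell-from n0 ns (last ρ) [] (subst (Linked Edge) (cong₂ _∷_ e1 e2) lk)) (++-identityʳ _))

  windowStructure : IntervalStructure n
  windowStructure = record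
    { Interval = List⁺ S × ℕ
    ; Holds = λ q (Q , s) → All (λ x → q ∈ μ K x) (drop s (toList Q))
    ; Prefix = λ (Q , s) (Q' , s') → (s' ≡ s) × Σ (List⁺ S) (λ Q'' → Q ≡ Q' ⁺++⁺ Q'') × (s < length (toList Q'))
    ; Suffix = λ (Q , s) (Q' , s') → (Q' ≡ Q) × (s < s') × (s' < length (toList Q))
    ; RightExt = λ (Q , s) (Q' , s') → (s' ≡ s) × Σ (List⁺ S) (λ Q'' → IsTrace K (Q ⁺++⁺ Q'') × Q' ≡ Q ⁺++⁺ Q'')
    ; LeftExt = λ (Q , s) (Q' , s') → (Q' ≡ Q) × (s' < s)
    }

  treeStructure : IntervalStructure n
  treeStructure = traceStructure (C K)

  holds-window : ∀ {ρ τ} → Spells ρ τ → ∀ q → Holds treeStructure q ρ ⇔ Holds windowStructure q τ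
  holds-window {ρ} {Q , s} (lk , eQ , l) q =
    mk⇔ (λ a → subst (All _) (sym drop-Q) (AP.map⁺ a)) (λ a → AP.map⁻ (subst (All _) drop-Q a))
    where
    drop-Q : drop s (toList Q) ≡ L.map lastState (toList ρ)
    drop-Q = trans (cong (drop s) eQ) (drop-spell (N.head ρ) (N.tail ρ) s l)

  prefix-forth : Forth treeStructure windowStructure (Prefix treeStructure) (Prefix windowStructure) Spells Spells
  prefix-forth {ρ} {Q , s} {ρ1} (lk , eQ , l) (ρ2 , refl) =
    (Q1 , s) , (refl , (N.map lastState ρ2 , toList-injective (trans eQ (spell-++ (N.head ρ1) (N.tail ρ1) (toList ρ2)))) ,
                 ≤-trans (≤-reflexive (sym l)) (≤-trans (m≤m+n _ _) (≤-reflexive (sym (length-spell (N.head ρ1) (N.tail ρ1)))))) ,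
    (Linked-++⁻ˡ (toList ρ1) lk , refl , l)
    where
    Q1 : List⁺ S
    Q1 = proj₁ (N.head ρ1) ⁺++ L.map lastState (N.tail ρ1)

  prefix-back : Back treeStructure windowStructure (Prefix treeStructure) (Prefix windowStructure) Spells Spells
  prefix-back {ρ} {Q , s} {Q1 , .s} (lk , eQ , l) (refl , (Q2 , refl) , lt) with <⇒≡+suc lt
  ... | k , lQ1 with splitAt⁺ ρ (suc k) (s≤s z≤n)
                      (+-cancelˡ-< s _ _ (≤-trans (≤-reflexive (cong suc (sym lQ1)))
                         (≤-trans (m<m+n _ (1≤length⁺ Q2)) (≤-reflexive (trans (sym (length-++ (toList Q1))) (length-window {ρ} {Q1 ⁺++⁺ Q2} (lk , eQ , l)))))))
  ...   | ρ1 , ρ2 , refl , lρ = ρ1 , (ρ2 , refl) , (Linked-++⁻ˡ (toList ρ1) lk ,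
          proj₁ (++-injective (toList Q1) (toList Q2) (spell (N.head ρ1) (N.tail ρ1)) (L.map lastState (toList ρ2))
                  (trans eQ (spell-++ (N.head ρ1) (N.tail ρ1) (toList ρ2)))
                  (trans lQ1 (sym (trans (length-spell (N.head ρ1) (N.tail ρ1)) (trans (cong (_+ length (N.tail ρ1)) l)
                     (trans (sym (+-suc s _)) (cong (s +_) lρ))))))) , l)

  spell-suffix : ∀ (ρ2 ρ1 : List⁺ Node) s → Linked Edge (toList (ρ2 ⁺++⁺ ρ1)) → length (path (N.head ρ2)) ≡ suc s →
           (spell (N.head ρ2) (N.tail ρ2 ++ toList ρ1) ≡ spell (N.head ρ1) (N.tail ρ1)) × (length (path (N.head ρ1)) ≡ suc (s + length (toList ρ2)))
  spell-suffix ρ2 ρ1 s lk l = qi , a+c≡s+[b+1+c]⇒a≡1+s+b _ _ (length (N.tail ρ1)) s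
      (trans (sym (length-spell (N.head ρ1) (N.tail ρ1))) (trans (cong length (sym qi)) (trans (length-spell (N.head ρ2) _)
        (trans (cong₂ _+_ l (length-++ (N.tail ρ2))) (sym (+-suc s _))))))
    where
    qi : spell (N.head ρ2) (N.tail ρ2 ++ toList ρ1) ≡ spell (N.head ρ1) (N.tail ρ1)
    qi = spell-from (N.head ρ2) (N.tail ρ2) (N.head ρ1) (N.tail ρ1) lk

  suffix-forth : Forth treeStructure windowStructure (Suffix treeStructure) (Suffix windowStructure) Spells Spells
  suffix-forth {ρ} {Q , s} {ρ1} (lk , eQ , l) (ρ2 , refl) =
    (Q , s + length (toList ρ2)) ,
    (refl , m<m+n s (1≤length⁺ ρ2) ,
      ≤-trans (m<m+n (s + length (toList ρ2)) (1≤length⁺ ρ1)) (≤-reflexive (sym (trans (length-window {ρ2 ⁺++⁺ ρ1} {Q} (lk , eQ , l))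
         (trans (cong (s +_) (length-++ (toList ρ2))) (sym (+-assoc s _ _))))))) ,
    (Linked-++⁻ʳ (toList ρ2) lk , trans eQ (proj₁ ls) , proj₂ ls)
    where
    ls : (spell (N.head ρ2) (N.tail ρ2 ++ toList ρ1) ≡ spell (N.head ρ1) (N.tail ρ1)) × (length (path (N.head ρ1)) ≡ suc (s + length (toList ρ2)))
    ls = spell-suffix ρ2 ρ1 s lk l

  suffix-back : Back treeStructure windowStructure (Suffix treeStructure) (Suffix windowStructure) Spells Spells
  suffix-back {ρ} {Q , s} {.Q , s1} (lk , eQ , l) (refl , s<s1 , s1<) with <⇒≡+suc s<s1
  ... | k , refl with splitAt⁺ ρ (suc k) (s≤s z≤n) (+-cancelˡ-< s _ _ (≤-trans s1< (≤-reflexive (length-window {ρ} {Q} (lk , eQ , l)))))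
  ...   | ρ2 , ρ1 , refl , lρ = ρ1 , (ρ2 , refl) , (Linked-++⁻ʳ (toList ρ2) lk , trans eQ (proj₁ ls) , trans (proj₂ ls) (cong (λ z → suc (s + z)) lρ))
    where
    ls : (spell (N.head ρ2) (N.tail ρ2 ++ toList ρ1) ≡ spell (N.head ρ1) (N.tail ρ1)) × (length (path (N.head ρ1)) ≡ suc (s + length (toList ρ2)))
    ls = spell-suffix ρ2 ρ1 s lk l

  rightExt-forth : Forth treeStructure windowStructure (RightExt treeStructure) (RightExt windowStructure) Spells Spells
  rightExt-forth {ρ} {Q , s} (lk , eQ , l) (ρ'' , tr , refl) =
    (Q ⁺++⁺ N.map lastState ρ'' , s) , (refl , (N.map lastState ρ'' , subst (Linked (δ K)) (sym eq) (spell-isTrace (N.head ρ) _ tr) , refl)) ,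
    (tr , eq , l)
    where
    eq : toList Q ++ L.map lastState (toList ρ'') ≡ spell (N.head ρ) (N.tail ρ ++ toList ρ'')
    eq = trans (cong (_++ L.map lastState (toList ρ'')) eQ) (sym (spell-++ (N.head ρ) (N.tail ρ) (toList ρ'')))

  rightExt-back : Back treeStructure windowStructure (RightExt treeStructure) (RightExt windowStructure) Spells Spells
  rightExt-back {ρ} {Q , s} {Q1 , .s} (lk , eQ , l) (refl , Q'' , trQ , refl) with toList≡init∷ʳlast (proj₁ (last ρ)) | toList≡init∷ʳlast ρ
  ... | ys , eL | zs , eρ with descendants (last ρ) (toList Q'')
         (Linked-++⁻ʳ ys (subst (Linked (δ K)) (trans (cong (_++ toList Q'') (trans eQ (trans (spell-last ρ lk) eL))) (++-assoc ys _ _)) trQ))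
  ...   | [] , lk2 , () 
  ...   | (a ∷ as) , lk2 , em =
          ρ ⁺++⁺ (a ∷ as) , ((a ∷ as) , tr , refl) ,
          (tr , trans (cong (_++ toList Q'') eQ) (trans (cong (spell (N.head ρ) (N.tail ρ) ++_) (sym em)) (sym (spell-++ (N.head ρ) (N.tail ρ) (a ∷ as)))) , l)
    where
    tr : Linked Edge (toList ρ ++ a ∷ as)
    tr = subst (Linked Edge) (trans (sym (++-assoc zs _ _)) (cong (_++ a ∷ as) (sym eρ))) (Linked-glue zs (subst (Linked Edge) eρ lk) lk2)

  leftExt-forth : Forth treeStructure windowStructure (LeftExt treeStructure) (LeftExt windowStructure) Spells Spells
  leftExt-forth {ρ} {Q , s} (lk , eQ , l) (ρ'' , tr , refl) =
    (Q , length (N.tail (proj₁ (N.head ρ'')))) ,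
    (refl , 1+a+[b+1+c]≡1+s+c⇒a<s _ (length (N.tail ρ'')) (length (N.tail ρ)) s
       (trans (cong (suc (length (N.tail (proj₁ (N.head ρ'')))) +_) (sym (length-++ (N.tail ρ''))))
       (trans (sym (length-spell (N.head ρ'') _)) (trans (cong length qi) (trans (length-spell (N.head ρ) (N.tail ρ)) (cong (_+ length (N.tail ρ)) l)))))) ,
    (tr , trans eQ (sym qi) , refl)
    where
    qi : spell (N.head ρ'') (N.tail ρ'' ++ toList ρ) ≡ spell (N.head ρ) (N.tail ρ)
    qi = spell-from (N.head ρ'') (N.tail ρ'') (N.head ρ) (N.tail ρ) tr

  leftExt-back : Back treeStructure windowStructure (LeftExt treeStructure) (LeftExt windowStructure) Spells Spells
  leftExt-back {ρ} {Q , s} {.Q , s1} (lk , eQ , l) (refl , s1<s) with <⇒≡+suc s1<s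
  ... | k , refl with ancestors k (N.head ρ) (≤-trans (s≤s (m≤n+m (suc k) s1)) (≤-reflexive (sym l)))
  ...   | ρ'' , lkf , lρ , hl = ρ'' ⁺++⁺ ρ , (ρ'' , tr , refl) ,
          (tr , trans eQ (sym (spell-from (N.head ρ'') (N.tail ρ'') (N.head ρ) (N.tail ρ) tr)) ,
           +-cancelʳ-≡ (suc k) _ (suc s1) (trans hl l))
    where
    tr : Linked Edge (toList (ρ'' ⁺++⁺ ρ))
    tr = lkf (N.tail ρ) lk

  initialWindow : ∀ ρ → IsInitialTrace (C K) ρ → Σ (List⁺ S) λ Q → IsInitialTrace K Q × Spells ρ (Q , 0)
  initialWindow ρ (lk , hd) =
    proj₁ (N.head ρ) ⁺++ L.map lastState (N.tail ρ) ,
    (spell-isTrace (N.head ρ) (N.tail ρ) lk , cong (λ nd → N.head (proj₁ nd)) hd) ,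
    (lk , refl , cong (λ nd → length (path nd)) hd)

  initialWindow⁻ : ∀ Q → IsInitialTrace K Q → Σ (List⁺ Node) λ ρ → IsInitialTrace (C K) ρ × Spells ρ (Q , 0)
  initialWindow⁻ Q (tr , hd) with descendants (s₀ (C K)) (N.tail Q) (subst (λ z → Linked (δ K) (z ∷ N.tail Q)) hd tr)
  ... | ns , lk , lastStates≡ = s₀ (C K) ∷ ns , (lk , refl) , (lk , cong₂ _∷_ hd (sym lastStates≡) , refl)

  computationTree≈window : GradedBisimulation treeStructure windowStructure
  computationTree≈window = record
    { Related = λ _ → Spells
    ; holds = holds-window
    ; prefix-forth = prefix-forth ; prefix-back = prefix-back
    ; suffix-forth = suffix-forth ; suffix-back = suffix-back
    ; rightExt-forth = rightExt-forth ; rightExt-back = rightExt-back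
    ; leftExt-forth = leftExt-forth ; leftExt-back = leftExt-back
    }

  Sat⇔ISat-window : ∀ ψ {ρ τ} → Spells ρ τ → Sat (C K) ρ ψ ⇔ ISat windowStructure τ ψ
  Sat⇔ISat-window ψ {ρ} {τ} r = Related⇒ISat⇔ computationTree≈window ψ (modalDepth ψ) ≤-refl r ⇔-∘ Sat⇔ISat (C K) ψ ρ

  ⊨ct⇔initialWindows : ∀ ψ → K ⊨ct ψ ⇔ (∀ Q → IsInitialTrace K Q → ISat windowStructure (Q , 0) ψ)
  ⊨ct⇔initialWindows ψ = mk⇔ (λ sat Q initial → to-window sat (initialWindow⁻ Q initial))
                             (λ sat ρ initial → from-window sat (initialWindow ρ initial))
    where
    to-window : ∀ {Q} → K ⊨ct ψ → Σ (List⁺ Node) (λ ρ → IsInitialTrace (C K) ρ × Spells ρ (Q , 0)) → ISat windowStructure (Q , 0) ψ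
    to-window sat (ρ , initial , spells) = to (Sat⇔ISat-window ψ spells) (sat ρ initial)
    from-window : ∀ {ρ} → (∀ Q → IsInitialTrace K Q → ISat windowStructure (Q , 0) ψ) →
                  Σ (List⁺ S) (λ Q → IsInitialTrace K Q × Spells ρ (Q , 0)) → Sat (C K) ρ ψ
    from-window sat (Q , initial , spells) = from (Sat⇔ISat-window ψ spells) (sat Q initial)

_≈[_]_ : ℕ → ℕ → ℕ → Set
x ≈[ t ] y = (x ≡ y) ⊎ ((t ≤ x) × (t ≤ y))

threshold : ℕ → ℕ
threshold zero = 2
threshold (suc h) = threshold h + threshold h

2≤threshold : ∀ h → 2 ≤ threshold h
2≤threshold zero = ≤-refl
2≤threshold (suc h) = ≤-trans (2≤threshold h) (m≤m+n _ _)

≈-refl : ∀ {x t} → x ≈[ t ] x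
≈-refl = inj₁ refl

≈-sym : ∀ {x y t} → x ≈[ t ] y → y ≈[ t ] x
≈-sym (inj₁ e) = inj₁ (sym e)
≈-sym (inj₂ (a , b)) = inj₂ (b , a)

≈-large : ∀ {x y t} → t ≤ x → t ≤ y → x ≈[ t ] y
≈-large a b = inj₂ (a , b)

≈-weaken : ∀ {x y t T} → t ≤ T → x ≈[ T ] y → x ≈[ t ] y
≈-weaken _ (inj₁ e) = inj₁ e
≈-weaken le (inj₂ (a , b)) = inj₂ (≤-trans le a , ≤-trans le b)

≈-+ : ∀ {x y x' y' t} → x ≈[ t ] y → x' ≈[ t ] y' → (x + x') ≈[ t ] (y + y')
≈-+ (inj₁ refl) (inj₁ refl) = inj₁ refl
≈-+ {x} {y} {x'} {y'} (inj₁ refl) (inj₂ (a , b)) = inj₂ (≤-trans a (m≤n+m x' x) , ≤-trans b (m≤n+m y' x))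
≈-+ {x} {y} {x'} {y'} (inj₂ (a , b)) _ = inj₂ (≤-trans a (m≤m+n x x') , ≤-trans b (m≤m+n y y'))

≈-⊓ : ∀ {x y t} M → t ≤ M → x ≈[ t ] y → (M ⊓ x) ≈[ t ] (M ⊓ y)
≈-⊓ M _ (inj₁ refl) = inj₁ refl
≈-⊓ M le (inj₂ (a , b)) = inj₂ (⊓-glb le a , ⊓-glb le b)

≈-small : ∀ {x y t} → x < t → x ≈[ t ] y → x ≡ y
≈-small _ (inj₁ e) = e
≈-small lt (inj₂ (a , _)) = ⊥-elim (<-irrefl refl (≤-trans lt a))

≈-1 : ∀ {x y t} → 2 ≤ t → x ≈[ t ] y → x ≡ 1 → y ≡ 1
≈-1 {t = t} 2≤t x≈y x≡1 = trans (sym (≈-small (subst (_< t) (sym x≡1) 2≤t) x≈y)) x≡1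

≈-positive : ∀ {x y t} → 1 ≤ t → 1 ≤ x → x ≈[ t ] y → 1 ≤ y
≈-positive _ p (inj₁ refl) = p
≈-positive 1≤t _ (inj₂ (_ , b)) = ≤-trans 1≤t b

large-summand : ∀ t a b → t + t ≤ a + b → b < t → t ≤ a
large-summand t a b h b<t with t ≤? a
... | yes t≤a = t≤a
... | no t≰a = ⊥-elim (<-irrefl refl (≤-trans (+-mono-< (≰⇒> t≰a) b<t) h))

1≤+-transport : ∀ {r r' j} → (1 ≤ r → 1 ≤ r') → 1 ≤ r + j → 1 ≤ r' + j
1≤+-transport {zero} f h = ≤-trans h (m≤n+m _ _)
1≤+-transport {suc r} f h = ≤-trans (f (s≤s z≤n)) (m≤m+n _ _)

record Split (t k r n : ℕ) : Set where
  constructor split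
  field
    k' r' : ℕ
    n≡k'+r' : n ≡ k' + r'
    k≈k' : k ≈[ t ] k'
    r≈r' : r ≈[ t ] r'
    1≤k' : 1 ≤ k → 1 ≤ k'
    1≤r' : 1 ≤ r → 1 ≤ r'

-- Splitting at threshold 2t to threshold t is what lets the thresholds halve along a play.
≈-split : ∀ t → 1 ≤ t → ∀ k r n → (k + r) ≈[ t + t ] n → Split t k r n
≈-split t 1≤t k r n (inj₁ refl) = split k r refl ≈-refl ≈-refl (λ p → p) (λ p → p)
≈-split t 1≤t k r n (inj₂ (big , big')) with k <? t | r <? t
... | yes k<t | _ = split k (n ∸ k) (sym (m+[n∸m]≡n k≤n)) ≈-refl (≈-large t≤r t≤n∸k) (λ p → p) (λ _ → ≤-trans 1≤t t≤n∸k)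
  where
  k≤n : k ≤ n
  k≤n = ≤-trans (<⇒≤ k<t) (≤-trans (m≤m+n t t) big')
  t≤r : t ≤ r
  t≤r = large-summand t r k (≤-trans big (≤-reflexive (+-comm k r))) k<t
  t≤n∸k : t ≤ n ∸ k
  t≤n∸k = large-summand t (n ∸ k) k (≤-trans big' (≤-reflexive (sym (m∸n+n≡m k≤n)))) k<t
... | no k≮t | yes r<t = split (n ∸ r) r (sym (m∸n+n≡m r≤n)) (≈-large (≮⇒≥ k≮t) t≤n∸r) ≈-refl (λ _ → ≤-trans 1≤t t≤n∸r) (λ p → p)
  where
  r≤n : r ≤ n
  r≤n = ≤-trans (<⇒≤ r<t) (≤-trans (m≤m+n t t) big')
  t≤n∸r : t ≤ n ∸ r
  t≤n∸r = large-summand t (n ∸ r) r (≤-trans big' (≤-reflexive (sym (m∸n+n≡m r≤n)))) r<t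
... | no k≮t | no r≮t =
  split t (n ∸ t) (sym (m+[n∸m]≡n t≤n)) (≈-large (≮⇒≥ k≮t) ≤-refl) (≈-large (≮⇒≥ r≮t) t≤n∸t) (λ _ → 1≤t) (λ _ → ≤-trans 1≤t t≤n∸t)
  where
  t≤n : t ≤ n
  t≤n = ≤-trans (m≤m+n t t) big'
  t≤n∸t : t ≤ n ∸ t
  t≤n∸t = +-cancelˡ-≤ t t (n ∸ t) (≤-trans big' (≤-reflexive (sym (m+[n∸m]≡n t≤n))))

module LadderWords (M : ℕ) (1≤M : 1 ≤ M) where

  Step : ℕ → ℕ → Set
  Step x y = (suc y ≡ x) ⊎ ((y ≡ x) × ((x ≡ 0) ⊎ (x ≡ M)))

  descent : ℕ → ℕ → List ℕ
  descent zero g = []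
  descent (suc m) g = (M ⊓ (m + g)) ∷ descent m g

  -- Every trace of the ladder is the word of a shape (decode): m heights descending to g, capped
  -- at M (a stay at the top shows up as repeated M's), followed by j zeros.
  record Shape : Set where
    constructor shape
    field m g j : ℕ
  open Shape public

  word : Shape → List ℕ
  word (shape m g j) = descent m g ++ replicate j 0

  size : Shape → ℕ
  size (shape m g j) = m + j

  -- The conditions fix g where it is not visible in the word, making word injective.
  record WellFormed (t : Shape) : Set where
    constructor wf
    field
      1≤g : 1 ≤ g t
      g≤M : g t ≤ M
      1≤size : 1 ≤ m t + j t
      zeros⇒g≡1 : 1 ≤ j t → 1 ≤ m t → g t ≡ 1
      m≡0⇒g≡1 : m t ≡ 0 → g t ≡ 1
  open WellFormed public

  wf⁺ : ∀ {m g j} → 1 ≤ m → 1 ≤ g → g ≤ M → (1 ≤ j → g ≡ 1) → WellFormed (shape m g j)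
  wf⁺ {m} 1≤m 1≤g g≤M zeros⇒g≡1 =
    wf 1≤g g≤M (≤-trans 1≤m (m≤m+n m _)) (λ j1 _ → zeros⇒g≡1 j1) (λ m≡0 → ⊥-elim (1+n≰n (≤-trans 1≤m (≤-reflexive m≡0))))

  large-floor⇒no-zeros : ∀ {m g j} → WellFormed (shape m g j) → 1 ≤ m → 2 ≤ g → j ≡ 0
  large-floor⇒no-zeros v 1≤m 2≤g = n≤0⇒n≡0 (≮⇒≥ (λ 1≤j → <-irrefl (sym (zeros⇒g≡1 v 1≤j 1≤m)) 2≤g))

  wf-zeros : ∀ {j} → 1 ≤ j → WellFormed (shape 0 1 j)
  wf-zeros 1≤j = wf (s≤s z≤n) 1≤M 1≤j (λ _ ()) (λ _ → refl)

  1≤M⊓ : ∀ {a} → 1 ≤ a → 1 ≤ M ⊓ a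
  1≤M⊓ h = ⊓-glb 1≤M h
  M⊓<M⇒≡ : ∀ a → M ⊓ a < M → M ⊓ a ≡ a
  M⊓<M⇒≡ a h with a ≤? M
  ... | yes p = m≥n⇒m⊓n≡n p
  ... | no p = ⊥-elim (<-irrefl (m≤n⇒m⊓n≡m (<⇒≤ (≰⇒> p))) h)
  ⊓-+-⊓ : ∀ i a → M ⊓ (i + M ⊓ a) ≡ M ⊓ (i + a)
  ⊓-+-⊓ i a with a ≤? M
  ... | yes p rewrite m≥n⇒m⊓n≡n p = refl
  ... | no p rewrite m≤n⇒m⊓n≡m (<⇒≤ (≰⇒> p)) =
    trans (m≤n⇒m⊓n≡m (m≤n+m M i)) (sym (m≤n⇒m⊓n≡m (≤-trans (<⇒≤ (≰⇒> p)) (m≤n+m a i))))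

  Step-descent : ∀ a → Step (M ⊓ suc a) (M ⊓ a)
  Step-descent a with suc a ≤? M
  ... | yes p rewrite m≥n⇒m⊓n≡n p | m≥n⇒m⊓n≡n (≤-trans (n≤1+n a) p) = inj₁ refl
  ... | no p rewrite m≤n⇒m⊓n≡m (≤-trans (≤-pred (≰⇒> p)) (n≤1+n a)) | m≤n⇒m⊓n≡m (≤-pred (≰⇒> p)) = inj₂ (refl , inj₂ refl)

  descent-+ : ∀ k r g → descent (k + r) g ≡ descent k (r + g) ++ descent r g
  descent-+ zero r g = refl
  descent-+ (suc k) r g = cong₂ _∷_ (cong (M ⊓_) (+-assoc k r g)) (descent-+ k r g)

  descent-⊓ : ∀ k a → descent k (M ⊓ a) ≡ descent k a
  descent-⊓ zero a = refl
  descent-⊓ (suc k) a = cong₂ _∷_ (⊓-+-⊓ k a) (descent-⊓ k a)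

  length-descent : ∀ m g → length (descent m g) ≡ m
  length-descent zero g = refl
  length-descent (suc m) g = cong suc (length-descent m g)

  length-word : ∀ t → length (word t) ≡ size t
  length-word (shape m g j) = trans (length-++ (descent m g)) (cong₂ _+_ (length-descent m g) (length-replicate j))

  Linked-zeros : ∀ j → Linked Step (replicate j 0)
  Linked-zeros zero = []
  Linked-zeros (suc zero) = [-]
  Linked-zeros (suc (suc j)) = inj₂ (refl , inj₁ refl) ∷ Linked-zeros (suc j)

  Linked-descent-++ : ∀ m g z → Linked Step z → (∀ {y ys} → z ≡ y ∷ ys → 1 ≤ m → Step (M ⊓ g) y) → Linked Step (descent m g ++ z)
  Linked-descent-++ zero g z lk h = lk
  Linked-descent-++ (suc zero) g [] lk h = [-]
  Linked-descent-++ (suc zero) g (y ∷ ys) lk h = h refl (s≤s z≤n) ∷ lk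
  Linked-descent-++ (suc (suc m)) g z lk h = Step-descent (m + g) ∷ Linked-descent-++ (suc m) g z lk (λ e _ → h e (s≤s z≤n))

  Linked-word : ∀ t → WellFormed t → Linked Step (word t)
  Linked-word (shape m g j) v = Linked-descent-++ m g (replicate j 0) (Linked-zeros j) (first-step j (zeros⇒g≡1 v))
    where
    first-step : ∀ j → (1 ≤ j → 1 ≤ m → g ≡ 1) → ∀ {y ys} → replicate j 0 ≡ y ∷ ys → 1 ≤ m → Step (M ⊓ g) y
    first-step (suc j') f refl m≥1 rewrite f (s≤s z≤n) m≥1 | m≥n⇒m⊓n≡n 1≤M = inj₁ refl

  word≤M : ∀ t → All (_≤ M) (word t)
  word≤M (shape m g j) = AP.++⁺ (descent≤M m) (AP.replicate⁺ j z≤n)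
    where
    descent≤M : ∀ m → All (_≤ M) (descent m g)
    descent≤M zero = []
    descent≤M (suc m) = m⊓n≤m M _ ∷ descent≤M m

  decode : ∀ x xs → All (_≤ M) (x ∷ xs) → Linked Step (x ∷ xs) → Σ Shape λ t → WellFormed t × (x ∷ xs) ≡ word t
  decode zero [] _ _ = shape 0 1 1 , wf-zeros (s≤s z≤n) , refl
  decode (suc x) [] (x≤M ∷ []) _ = shape 1 (suc x) 0 , wf⁺ (s≤s z≤n) (s≤s z≤n) x≤M (λ ()) , cong (_∷ []) (sym (m≥n⇒m⊓n≡n x≤M))
  decode x (y ∷ ys) (x≤M ∷ a) (st ∷ lk) with decode y ys a lk
  ... | shape zero g (suc j) , v , refl with st
  ...   | inj₁ refl = shape 1 1 (suc j) , wf⁺ (s≤s z≤n) (s≤s z≤n) 1≤M (λ _ → refl) , cong (_∷ 0 ∷ replicate j 0) (sym (m≥n⇒m⊓n≡n 1≤M))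
  ...   | inj₂ (refl , _) = shape 0 1 (suc (suc j)) , wf-zeros (s≤s z≤n) , refl
  decode x (y ∷ ys) (x≤M ∷ a) (st ∷ lk) | shape zero g zero , v , ()
  decode x (y ∷ ys) (x≤M ∷ a) (st ∷ lk) | shape (suc m) g j , v , refl =
    shape (suc (suc m)) g j , wf⁺ (s≤s z≤n) (1≤g v) (g≤M v) (λ j1 → zeros⇒g≡1 v j1 (s≤s z≤n)) , cong (_∷ _) (sym (step-up st))
    where
    step-up : Step x (M ⊓ (m + g)) → M ⊓ suc (m + g) ≡ x
    step-up (inj₁ e) = let c = M⊓<M⇒≡ (m + g) (≤-trans (≤-reflexive e) x≤M) in
                   trans (m≥n⇒m⊓n≡n (≤-trans (≤-reflexive (trans (cong suc (sym c)) e)) x≤M)) (trans (cong suc (sym c)) e)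
    step-up (inj₂ (e , inj₁ x0)) = ⊥-elim (1+n≰n (≤-trans (1≤M⊓ (≤-trans (1≤g v) (m≤n+m g m))) (≤-reflexive (trans e x0))))
    step-up (inj₂ (e , inj₂ xM)) = trans (m≤n⇒m⊓n≡m (≤-trans (m⊓n≡m⇒m≤n (trans e xM)) (n≤1+n _))) (sym xM)

  data PrefixShape : Shape → Shape → Set where
    prefix-descent : ∀ k r g j → 1 ≤ k → 1 ≤ r + j → PrefixShape (shape (k + r) g j) (shape k (M ⊓ (r + g)) 0)
    prefix-zeros : ∀ m g i d → 1 ≤ m + i → 1 ≤ d → PrefixShape (shape m g (i + d)) (shape m g i)

  prefix-descent-exact : ∀ {k r g j g1} → 1 ≤ k → 1 ≤ r + j → r + g ≡ g1 → g1 ≤ M →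
                         PrefixShape (shape (k + r) g j) (shape k g1 0)
  prefix-descent-exact {k} {r} {g} {j} 1≤k 1≤r+j r+g≡g1 g1≤M =
    subst (λ z → PrefixShape (shape (k + r) g j) (shape k z 0)) (trans (m≥n⇒m⊓n≡n (≤-trans (≤-reflexive r+g≡g1) g1≤M)) r+g≡g1)
          (prefix-descent k r g j 1≤k 1≤r+j)

  data SuffixShape : Shape → Shape → Set where
    suffix-descent : ∀ k r g j → 1 ≤ k → 1 ≤ r → SuffixShape (shape (k + r) g j) (shape r g j)
    suffix-zeros : ∀ m g i d → 1 ≤ m + i → 1 ≤ d → SuffixShape (shape m g (i + d)) (shape 0 1 d)

  word-prefix : ∀ {t t1} → PrefixShape t t1 → Σ (List ℕ) λ rest → (1 ≤ length rest) × word t ≡ word t1 ++ rest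
  word-prefix (prefix-descent k r g j k≥1 rj) = descent r g ++ replicate j 0 ,
    ≤-trans rj (≤-reflexive (sym (trans (length-++ (descent r g)) (cong₂ _+_ (length-descent r g) (length-replicate j))))) ,
    (begin
      descent (k + r) g ++ replicate j 0 ≡⟨ cong (_++ replicate j 0) (descent-+ k r g) ⟩
      (descent k (r + g) ++ descent r g) ++ replicate j 0 ≡⟨ ++-assoc (descent k (r + g)) _ _ ⟩
      descent k (r + g) ++ descent r g ++ replicate j 0 ≡⟨ cong (λ z → z ++ descent r g ++ replicate j 0) (trans (sym (descent-⊓ k (r + g))) (sym (++-identityʳ _))) ⟩
      (descent k (M ⊓ (r + g)) ++ []) ++ descent r g ++ replicate j 0 ∎)
    where open ≡-Reasoning
  word-prefix (prefix-zeros m g i d _ d≥1) = replicate d 0 , ≤-trans d≥1 (≤-reflexive (sym (length-replicate d))) ,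
    trans (cong (descent m g ++_) (replicate-+ i d 0)) (sym (++-assoc (descent m g) _ _))

  word-suffix : ∀ {t t1} → SuffixShape t t1 → Σ (List ℕ) λ rest → (1 ≤ length rest) × word t ≡ rest ++ word t1
  word-suffix (suffix-descent k r g j k≥1 _) = descent k (r + g) ,
    ≤-trans k≥1 (≤-reflexive (sym (length-descent k _))) ,
    trans (cong (_++ replicate j 0) (descent-+ k r g)) (++-assoc (descent k (r + g)) _ _)
  word-suffix (suffix-zeros m g i d mi _) = descent m g ++ replicate i 0 ,
    ≤-trans mi (≤-reflexive (sym (trans (length-++ (descent m g)) (cong₂ _+_ (length-descent m g) (length-replicate i))))) ,
    trans (cong (descent m g ++_) (replicate-+ i d 0)) (sym (++-assoc (descent m g) _ _))

  prefixShape-of-length : ∀ t → WellFormed t → ∀ k → 1 ≤ k → k < size t → Σ Shape λ t1 → PrefixShape t t1 × size t1 ≡ k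
  prefixShape-of-length (shape m g j) v k k≥1 k<l with k ≤? m
  ... | yes k≤m with ≤⇒≡+ k≤m
  ...   | r , refl = shape k (M ⊓ (r + g)) 0 , prefix-descent k r g j k≥1 (m<m+n⇒0<n k (r + j) (≤-trans k<l (≤-reflexive (+-assoc k r j)))) , +-identityʳ k
  prefixShape-of-length (shape m g j) v k k≥1 k<l | no k≰m with ≤⇒≡+ (<⇒≤ (≰⇒> k≰m))
  ...   | i , refl with <⇒≡+suc (+-cancelˡ-≤ m (suc i) j (≤-trans (≤-reflexive (+-suc m i)) k<l))
  ...     | d , refl = shape m g i , prefix-zeros m g i (suc d) k≥1 (s≤s z≤n) , refl

  suffixShape-of-length : ∀ t → WellFormed t → ∀ k → 1 ≤ k → k < size t → Σ Shape λ t1 → SuffixShape t t1 × k + size t1 ≡ size t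
  suffixShape-of-length (shape m g j) v k k≥1 k<l with suc k ≤? m
  ... | yes k<m with ≤⇒≡+ k<m
  ...   | r , refl = shape (suc r) g j , subst (λ z → SuffixShape (shape z g j) (shape (suc r) g j)) (+-suc k r) (suffix-descent k (suc r) g j k≥1 (s≤s z≤n)) ,
                     trans (sym (+-assoc k (suc r) j)) (cong (_+ j) (+-suc k r))
  suffixShape-of-length (shape m g j) v k k≥1 k<l | no k≮m with ≤⇒≡+ (≤-pred (≰⇒> k≮m))
  ...   | i , refl with <⇒≡+suc (+-cancelˡ-≤ m (suc i) j (≤-trans (≤-reflexive (+-suc m i)) k<l))
  ...     | d , refl = shape 0 1 (suc d) , suffix-zeros m g i (suc d) k≥1 (s≤s z≤n) , +-assoc m i (suc d)

  wf-prefix : ∀ {t t1} → WellFormed t → PrefixShape t t1 → WellFormed t1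
  wf-prefix v (prefix-descent k r g j k≥1 _) = wf⁺ k≥1 (1≤M⊓ (≤-trans (1≤g v) (m≤n+m g r))) (m⊓n≤m M _) (λ ())
  wf-prefix v (prefix-zeros m g i d mi d≥1) = wf (1≤g v) (g≤M v) mi (λ i≥1 m≥1 → zeros⇒g≡1 v (≤-trans i≥1 (m≤m+n i d)) m≥1) (m≡0⇒g≡1 v)

  wf-suffix : ∀ {t t1} → WellFormed t → SuffixShape t t1 → WellFormed t1
  wf-suffix v (suffix-descent k r g j k≥1 r≥1) = wf⁺ r≥1 (1≤g v) (g≤M v) (λ j≥1 → zeros⇒g≡1 v j≥1 (≤-trans k≥1 (m≤m+n k r)))
  wf-suffix v (suffix-zeros m g i d _ d≥1) = wf-zeros d≥1

  countZeros : List ℕ → ℕ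
  countZeros [] = 0
  countZeros (zero ∷ xs) = suc (countZeros xs)
  countZeros (suc _ ∷ xs) = countZeros xs

  countZeros-word : ∀ m g j → 1 ≤ g → countZeros (word (shape m g j)) ≡ j
  countZeros-word zero g j _ = countZeros-replicate j
    where
    countZeros-replicate : ∀ j → countZeros (replicate j 0) ≡ j
    countZeros-replicate zero = refl
    countZeros-replicate (suc j) = cong suc (countZeros-replicate j)
  countZeros-word (suc m) g j 1≤g with M ⊓ (m + g) | 1≤M⊓ (≤-trans 1≤g (m≤n+m g m))
  ... | suc _ | _ = countZeros-word m g j 1≤g

  drop-descent : ∀ m₀ g z → drop m₀ (descent (suc m₀) g ++ z) ≡ (M ⊓ g) ∷ z
  drop-descent zero g z = refl
  drop-descent (suc m₀) g z = drop-descent m₀ g z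

  word-injective-floor : ∀ m g g' j → WellFormed (shape m g j) → WellFormed (shape m g' j) →
                         word (shape m g j) ≡ word (shape m g' j) → shape m g j ≡ shape m g' j
  word-injective-floor zero g g' j v v' e = cong (λ z → shape 0 z j) (trans (m≡0⇒g≡1 v refl) (sym (m≡0⇒g≡1 v' refl)))
  word-injective-floor (suc m₀) g g' j v v' e = cong (λ z → shape (suc m₀) z j)
    (∷-injectiveˡ (trans (sym (trans (drop-descent m₀ g _) (cong (_∷ _) (m≥n⇒m⊓n≡n (g≤M v)))))
                         (trans (cong (drop m₀) e) (trans (drop-descent m₀ g' _) (cong (_∷ _) (m≥n⇒m⊓n≡n (g≤M v')))))))

  word-injective : ∀ {t t'} → WellFormed t → WellFormed t' → word t ≡ word t' → t ≡ t'
  word-injective {shape m g j} {shape m' g' j'} v v' e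
    with trans (sym (countZeros-word m g j (1≤g v))) (trans (cong countZeros e) (countZeros-word m' g' j' (1≤g v')))
  ... | refl with +-cancelʳ-≡ j m m' (trans (sym (length-word (shape m g j))) (trans (cong length e) (length-word (shape m' g' j))))
  ... | refl = word-injective-floor m g g' j v v' e

module ShapeGames (M : ℕ) (1≤M : 1 ≤ M) where
  open LadderWords M 1≤M

  SimilarShapes : ℕ → Shape → Shape → Set
  SimilarShapes h t t' = (j t ≡ j t') × (m t ≈[ threshold h ] m t') × (g t ≈[ threshold h ] g t')

  SimilarShapes-sym : ∀ {h t t'} → SimilarShapes h t t' → SimilarShapes h t' t
  SimilarShapes-sym (a , b , c) = sym a , ≈-sym b , ≈-sym c

  SimilarShapes-refl : ∀ {h t} → SimilarShapes h t t
  SimilarShapes-refl = refl , ≈-refl , ≈-refl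

  -- A window (t , s) is a shape with an offset s < size t; the offset lies either in the descent
  -- (m t = s + w, w ≥ 1) or in the block of zeros (s = m t + b).
  record InDescent (τ : ℕ) (t : Shape) (s : ℕ) (t' : Shape) (s' : ℕ) : Set where
    constructor inDescent
    field
      w w' : ℕ
      m≡s+w : m t ≡ s + w
      m'≡s'+w' : m t' ≡ s' + w'
      1≤w : 1 ≤ w
      1≤w' : 1 ≤ w'
      s≈s' : s ≈[ τ ] s'
      w≈w' : w ≈[ τ ] w'

  record InZeros (τ : ℕ) (t : Shape) (s : ℕ) (t' : Shape) (s' : ℕ) : Set where
    constructor inZeros
    field
      b : ℕ
      s≡m+b : s ≡ m t + b
      s'≡m'+b : s' ≡ m t' + b
      m≈m' : m t ≈[ τ ] m t'

  SimilarWindows : ℕ → Shape → ℕ → Shape → ℕ → Set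
  SimilarWindows h t s t' s' =
    (j t ≡ j t') × (g t ≈[ threshold h ] g t') × (InDescent (threshold h) t s t' s' ⊎ InZeros (threshold h) t s t' s')

  SimilarWindows-sym : ∀ {h t s t' s'} → SimilarWindows h t s t' s' → SimilarWindows h t' s' t s
  SimilarWindows-sym (a , b , inj₁ (inDescent w w' ew ew' w1 w1' ss ww)) =
    sym a , ≈-sym b , inj₁ (inDescent w' w ew' ew w1' w1 (≈-sym ss) (≈-sym ww))
  SimilarWindows-sym (a , b , inj₂ (inZeros x eb eb' mm)) = sym a , ≈-sym b , inj₂ (inZeros x eb' eb (≈-sym mm))

  PrefixShape-shift : ∀ c {a g j b g1 j1} → PrefixShape (shape a g j) (shape b g1 j1) →
                      PrefixShape (shape (c + a) g j) (shape (c + b) g1 j1)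
  PrefixShape-shift c (prefix-descent k r g j k1 rj) =
    subst (λ z → PrefixShape (shape z g j) (shape (c + k) (M ⊓ (r + g)) 0)) (+-assoc c k r)
          (prefix-descent (c + k) r g j (≤-trans k1 (m≤n+m k c)) rj)
  PrefixShape-shift c (prefix-zeros m g i d mi d1) = prefix-zeros (c + m) g i d (≤-trans mi (+-monoˡ-≤ i (m≤n+m m c))) d1

  record Unshifted (s w : ℕ) (t'' t : Shape) : Set where
    constructor unshifted
    field
      a : ℕ
      m≡s+a : m t'' ≡ s + a
      prefix : PrefixShape (shape a (g t'') (j t'')) (shape w (g t) (j t))
      1≤a : 1 ≤ a

  unshift : ∀ {s w t'' t} → PrefixShape t'' t → m t ≡ s + w → 1 ≤ w → Unshifted s w t'' t
  unshift {s} {w} (prefix-descent k r g j k1 rj) ew w1 =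
    unshifted (w + r) (trans (cong (_+ r) ew) (+-assoc s w r)) (prefix-descent w r g j w1 rj) (≤-trans w1 (m≤m+n w r))
  unshift {s} {w} (prefix-zeros m g i d mi d1) ew w1 = unshifted w ew (prefix-zeros w g i d (≤-trans w1 (m≤m+n w i)) d1) w1

  module _ (h : ℕ) (τ⁺≤M : threshold (suc h) ≤ M) where
    private
      τ : ℕ
      τ = threshold h
      τ≤τ⁺ : τ ≤ threshold (suc h)
      τ≤τ⁺ = m≤m+n τ τ
      τ≤M : τ ≤ M
      τ≤M = ≤-trans τ≤τ⁺ τ⁺≤M
      1≤τ : 1 ≤ τ
      1≤τ = ≤-trans (s≤s z≤n) (2≤threshold h)
      1≤τ⁺ : 1 ≤ threshold (suc h)
      1≤τ⁺ = ≤-trans 1≤τ τ≤τ⁺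
      weaken : ∀ {x y} → x ≈[ threshold (suc h) ] y → x ≈[ τ ] y
      weaken = ≈-weaken τ≤τ⁺
      1≤+-≈ : ∀ {m m' i} → m ≈[ threshold (suc h) ] m' → 1 ≤ m + i → 1 ≤ m' + i
      1≤+-≈ mm = 1≤+-transport (λ p → ≈-positive 1≤τ⁺ p mm)

    similar-prefix : ∀ {t t' t1} → SimilarShapes (suc h) t t' → PrefixShape t t1 →
                     Σ Shape λ t1' → PrefixShape t' t1' × SimilarShapes h t1 t1'
    similar-prefix {t' = shape m' g' j'} (refl , mm , gg) (prefix-descent k r g j k1 rj)
      with ≈-split τ 1≤τ k r m' mm
    ... | split k' r' refl kk rr k1' r1' =
      shape k' (M ⊓ (r' + g')) 0 , prefix-descent k' r' g' j (k1' k1) (1≤+-transport r1' rj) ,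
      (refl , kk , ≈-⊓ M τ≤M (≈-+ rr (weaken gg)))
    similar-prefix {t' = shape m' g' j'} (refl , mm , gg) (prefix-zeros m g i d mi d1) =
      shape m' g' i , prefix-zeros m' g' i d (1≤+-≈ mm mi) d1 , (refl , weaken mm , weaken gg)

    similar-suffix : ∀ {t t' t1} → SimilarShapes (suc h) t t' → SuffixShape t t1 →
                     Σ Shape λ t1' → SuffixShape t' t1' × SimilarShapes h t1 t1'
    similar-suffix {t' = shape m' g' j'} (refl , mm , gg) (suffix-descent k r g j k1 r1)
      with ≈-split τ 1≤τ k r m' mm
    ... | split k' r' refl kk rr k1' r1' = shape r' g' j , suffix-descent k' r' g' j (k1' k1) (r1' r1) , (refl , rr , weaken gg)
    similar-suffix {t' = shape m' g' j'} (refl , mm , gg) (suffix-zeros m g i d mi d1) =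
      shape 0 1 d , suffix-zeros m' g' i d (1≤+-≈ mm mi) d1 , SimilarShapes-refl {h}

    similar-leftExt : ∀ {t t' t''} → SimilarShapes (suc h) t t' → WellFormed t' → WellFormed t'' → SuffixShape t'' t →
                      Σ Shape λ t''' → WellFormed t''' × SuffixShape t''' t' × SimilarShapes h t'' t'''
    similar-leftExt {t' = shape r' g' j'} (refl , mm , gg) v' v'' (suffix-descent k r g j k1 r1) =
      shape (k + r') g' j , wf⁺ (≤-trans k1 (m≤m+n k r')) (1≤g v') (g≤M v') (λ j1 → zeros⇒g≡1 v' j1 1≤r') ,
      suffix-descent k r' g' j k1 1≤r' , (refl , ≈-+ (≈-refl {k}) (weaken mm) , weaken gg)
      where
      1≤r' : 1 ≤ r'
      1≤r' = ≈-positive 1≤τ⁺ r1 mm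
    similar-leftExt {t' = shape m' g' j'} (refl , mm , gg) v' v'' (suffix-zeros m g i d mi d1)
      with ≈-small (≤-trans 1≤τ τ≤τ⁺) mm
    ... | refl with m≡0⇒g≡1 v' refl
    ...   | refl = shape m g (i + d) , v'' , suffix-zeros m g i d mi d1 , SimilarShapes-refl {h}

    private
      prefix-extension :
        ∀ {k r g'' j'' m' g'} → WellFormed (shape m' g' 0) → 1 ≤ m' → ∀ x y → 1 ≤ y → 1 ≤ x + j'' → (1 ≤ j'' → y ≡ 1) →
        x + y ≡ g' → (k + r) ≈[ τ ] (m' + x) → g'' ≈[ τ ] y →
        Σ Shape λ t''' → WellFormed t''' × PrefixShape t''' (shape m' g' 0) × SimilarShapes h (shape (k + r) g'' j'') t'''
      prefix-extension {j'' = j''} {m'} v' 1≤m' x y 1≤y xj y≡1 x+y≡g' m≈ g≈ =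
        shape (m' + x) y j'' ,
        wf⁺ (≤-trans 1≤m' (m≤m+n m' x)) 1≤y (≤-trans (m≤n+m y x) (≤-trans (≤-reflexive x+y≡g') (g≤M v'))) y≡1 ,
        prefix-descent-exact 1≤m' xj x+y≡g' (g≤M v') , (refl , m≈ , g≈)

      -- A small floor g'' of the extension is copied; a large one is replaced by a large value
      -- that fits into g'.
      rightExt-large-floor :
        ∀ {k r g'' j'' m' g'} → WellFormed (shape (k + r) g'' j'') → WellFormed (shape m' g' 0) → 1 ≤ k →
        k ≈[ threshold (suc h) ] m' → 1 ≤ r + j'' → threshold (suc h) ≤ r + g'' → threshold (suc h) ≤ g' →
        Σ Shape λ t''' → WellFormed t''' × PrefixShape t''' (shape m' g' 0) × SimilarShapes h (shape (k + r) g'' j'') t'''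
      rightExt-large-floor {k} {r} {g''} {j''} {m'} {g'} v'' v' k1 mm rj big big' with g'' <? τ
      ... | yes g''<τ =
        prefix-extension {k} {r} v' (≈-positive 1≤τ⁺ k1 mm) (g' ∸ g'') g'' (1≤g v'') (≤-trans (≤-trans 1≤τ τ≤g'∸g'') (m≤m+n _ j''))
          (λ j1 → zeros⇒g≡1 v'' j1 (≤-trans k1 (m≤m+n k r))) g'∸g''+g''≡g'
          (≈-large (≤-trans (large-summand τ r g'' big g''<τ) (m≤n+m r k)) (≤-trans τ≤g'∸g'' (m≤n+m _ m'))) ≈-refl
        where
        g'∸g''+g''≡g' : g' ∸ g'' + g'' ≡ g'
        g'∸g''+g''≡g' = m∸n+n≡m (≤-trans (<⇒≤ g''<τ) (≤-trans τ≤τ⁺ big'))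
        τ≤g'∸g'' : τ ≤ g' ∸ g''
        τ≤g'∸g'' = large-summand τ (g' ∸ g'') g'' (≤-trans big' (≤-reflexive (sym g'∸g''+g''≡g'))) g''<τ
      ... | no g''≮τ with large-floor⇒no-zeros v'' (≤-trans k1 (m≤m+n k r)) (≤-trans (2≤threshold h) (≮⇒≥ g''≮τ))
      ...   | refl with r + τ ≤? g'
      ...     | yes r+τ≤g' =
        prefix-extension {k} {r} v' (≈-positive 1≤τ⁺ k1 mm) r (g' ∸ r) (≤-trans 1≤τ τ≤g'∸r) rj (λ ()) r+[g'∸r]≡g'
          (≈-+ (weaken mm) ≈-refl) (≈-large (≮⇒≥ g''≮τ) τ≤g'∸r)
        where
        r+[g'∸r]≡g' : r + (g' ∸ r) ≡ g'
        r+[g'∸r]≡g' = m+[n∸m]≡n (≤-trans (m≤m+n r τ) r+τ≤g')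
        τ≤g'∸r : τ ≤ g' ∸ r
        τ≤g'∸r = +-cancelˡ-≤ r τ (g' ∸ r) (≤-trans r+τ≤g' (≤-reflexive (sym r+[g'∸r]≡g')))
      ...     | no r+τ≰g' =
        prefix-extension {k} {r} v' (≈-positive 1≤τ⁺ k1 mm) (g' ∸ τ) τ 1≤τ (≤-trans (≤-trans 1≤τ τ≤g'∸τ) (m≤m+n _ 0)) (λ ()) g'∸τ+τ≡g'
          (≈-large (≤-trans τ≤r (m≤n+m r k)) (≤-trans τ≤g'∸τ (m≤n+m _ m'))) (≈-large (≮⇒≥ g''≮τ) ≤-refl)
        where
        g'∸τ+τ≡g' : g' ∸ τ + τ ≡ g'
        g'∸τ+τ≡g' = m∸n+n≡m (≤-trans τ≤τ⁺ big')
        τ≤g'∸τ : τ ≤ g' ∸ τ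
        τ≤g'∸τ = +-cancelʳ-≤ τ τ (g' ∸ τ) (≤-trans big' (≤-reflexive (sym g'∸τ+τ≡g')))
        τ≤r : τ ≤ r
        τ≤r = <⇒≤ (+-cancelʳ-< τ τ r (≤-trans (s≤s big') (≰⇒> r+τ≰g')))

    similar-rightExt : ∀ {t t' t''} → SimilarShapes (suc h) t t' → WellFormed t' → WellFormed t'' → PrefixShape t'' t →
                       Σ Shape λ t''' → WellFormed t''' × PrefixShape t''' t' × SimilarShapes h t'' t'''
    similar-rightExt {t' = shape m' g' j'} (refl , mm , gg) v' v'' (prefix-zeros m g i d mi d1) =
      shape m' g' (i + d) ,
      wf (1≤g v') (g≤M v') (≤-trans (1≤+-≈ mm mi) (+-monoʳ-≤ m' (m≤m+n i d)))
         (λ j1 m1 → ≈-1 (2≤threshold (suc h)) gg (zeros⇒g≡1 v'' j1 (≈-positive 1≤τ⁺ m1 (≈-sym mm))))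
         (m≡0⇒g≡1 v') ,
      prefix-zeros m' g' i d (1≤+-≈ mm mi) d1 , (refl , weaken mm , weaken gg)
    similar-rightExt {t' = shape m' g' j'} (refl , mm , inj₁ refl) v' v'' (prefix-descent k r g'' j'' k1 rj) =
      shape (m' + r) g'' j'' , wf⁺ (≤-trans 1≤m' (m≤m+n m' r)) (1≤g v'') (g≤M v'') (λ j1 → zeros⇒g≡1 v'' j1 (≤-trans k1 (m≤m+n k r))) ,
      prefix-descent m' r g'' j'' 1≤m' rj , (refl , ≈-+ (weaken mm) ≈-refl , ≈-refl)
      where
      1≤m' : 1 ≤ m'
      1≤m' = ≈-positive 1≤τ⁺ k1 mm
    similar-rightExt {t' = shape m' g' j'} (refl , mm , inj₂ (big , big')) v' v'' (prefix-descent k r g'' j'' k1 rj) =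
      rightExt-large-floor v'' v' k1 mm rj (≤-trans big (m⊓n≤n M (r + g''))) big'

    similarWindow-suffix : ∀ {t s t' s' s1} → SimilarWindows (suc h) t s t' s' → s < s1 → s1 < size t →
                           Σ ℕ λ s1' → (s' < s1') × (s1' < size t') × SimilarWindows h t s1 t' s1'
    similarWindow-suffix {shape m g j} {s} {shape m' g' j'} {s'} {s1} (refl , gg , inj₁ (inDescent w w' refl refl w1 w1' ss ww)) s<s1 s1<l
      with s1 <? s + w
    ... | yes s1<m with <⇒≡+suc s<s1 | <⇒≡+suc s1<m
    ...   | k , refl | r , e2
      with ≈-split τ 1≤τ (suc k) (suc r) w' (subst (λ z → z ≈[ threshold (suc h) ] w') (+-cancelˡ-≡ s _ _ (trans e2 (+-assoc s (suc k) (suc r)))) ww)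
    ...     | split k' r' refl kk rr k1' r1' =
      s' + k' , m<m+n s' (k1' (s≤s z≤n)) ,
      ≤-trans (≤-trans (m<m+n (s' + k') (r1' (s≤s z≤n))) (≤-reflexive (+-assoc s' k' r'))) (m≤m+n _ j') ,
      (refl , weaken gg , inj₁ (inDescent (suc r) r' e2 (sym (+-assoc s' k' r')) (s≤s z≤n) (r1' (s≤s z≤n)) (≈-+ (weaken ss) kk) rr))
    similarWindow-suffix {shape m g j} {s} {shape m' g' j'} {s'} {s1} (refl , gg , inj₁ (inDescent w w' refl refl w1 w1' ss ww)) s<s1 s1<l
      | no s1≮m with ≤⇒≡+ (≮⇒≥ s1≮m)
    ...   | b , refl =
      (s' + w') + b , ≤-trans (m<m+n s' w1') (m≤m+n _ b) , +-monoʳ-< (s' + w') (+-cancelˡ-< (s + w) b j s1<l) ,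
      (refl , weaken gg , inj₂ (inZeros b refl refl (≈-+ (weaken ss) (weaken ww))))
    similarWindow-suffix {shape m g j} {s} {shape m' g' j'} {s'} {s1} (refl , gg , inj₂ (inZeros b refl refl mm)) s<s1 s1<l
      with <⇒≡+suc s<s1
    ... | k , refl =
      m' + (b + suc k) , +-monoʳ-< m' (m<m+n b (s≤s z≤n)) ,
      +-monoʳ-< m' (+-cancelˡ-< m _ j (≤-trans (≤-reflexive (cong suc (sym (+-assoc m b (suc k))))) s1<l)) ,
      (refl , weaken gg , inj₂ (inZeros (b + suc k) (+-assoc m b (suc k)) refl (weaken mm)))

    similarWindow-leftExt : ∀ {t s t' s' s1} → SimilarWindows (suc h) t s t' s' → s1 < s →
                            Σ ℕ λ s1' → (s1' < s') × SimilarWindows h t s1 t' s1'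
    similarWindow-leftExt {shape m g j} {s} {shape m' g' j'} {s'} {s1} (refl , gg , inj₁ (inDescent w w' refl refl w1 w1' ss ww)) s1<s
      with <⇒≡+suc s1<s
    ... | k , refl with ≈-split τ 1≤τ s1 (suc k) s' ss
    ...   | split s1'' k' refl kk rr k1' r1' =
      s1'' , m<m+n s1'' (r1' (s≤s z≤n)) ,
      (refl , weaken gg , inj₁ (inDescent (suc k + w) (k' + w') (+-assoc s1 (suc k) w) (+-assoc s1'' k' w') (s≤s z≤n)
                                          (≤-trans (r1' (s≤s z≤n)) (m≤m+n k' w')) kk (≈-+ rr (weaken ww))))
    similarWindow-leftExt {shape m g j} {s} {shape m' g' j'} {s'} {s1} (refl , gg , inj₂ (inZeros b refl refl mm)) s1<s
      with s1 <? m
    ... | no s1≮m with ≤⇒≡+ (≮⇒≥ s1≮m)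
    ...   | b1 , refl = m' + b1 , +-monoʳ-< m' (+-cancelˡ-< m b1 b s1<s) , (refl , weaken gg , inj₂ (inZeros b1 refl refl (weaken mm)))
    similarWindow-leftExt {shape m g j} {s} {shape m' g' j'} {s'} {s1} (refl , gg , inj₂ (inZeros b refl refl mm)) s1<s
      | yes s1<m with <⇒≡+suc s1<m
    ...   | k , refl with ≈-split τ 1≤τ s1 (suc k) m' mm
    ...     | split s1'' w'' refl kk rr k1' r1' =
      s1'' , ≤-trans (m<m+n s1'' (r1' (s≤s z≤n))) (m≤m+n _ b) ,
      (refl , weaken gg , inj₁ (inDescent (suc k) w'' refl refl (s≤s z≤n) (r1' (s≤s z≤n)) kk rr))

    similarWindow-prefix : ∀ {t s t' s' t1} → SimilarWindows (suc h) t s t' s' → PrefixShape t t1 → s < size t1 →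
                           Σ Shape λ t1' → PrefixShape t' t1' × (s' < size t1') × SimilarWindows h t1 s t1' s'
    similarWindow-prefix {s = s} {t' = shape m' g' j'} {s' = s'} (refl , gg , inj₁ (inDescent w w' ew refl w1 w1' ss ww)) (prefix-descent k r g j k1 rj) s<l
      with <⇒≡+suc (≤-trans s<l (≤-reflexive (+-identityʳ k)))
    ... | w1x , refl
      with ≈-split τ 1≤τ (suc w1x) r w' (subst (λ z → z ≈[ threshold (suc h) ] w') (+-cancelˡ-≡ s _ _ (trans (sym ew) (+-assoc s (suc w1x) r))) ww)
    ...   | split k' r' refl kk rr k1' r1' =
      shape (s' + k') (M ⊓ (r' + g')) 0 ,
      subst (λ z → PrefixShape (shape z g' j) (shape (s' + k') (M ⊓ (r' + g')) 0)) (+-assoc s' k' r')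
            (prefix-descent (s' + k') r' g' j (≤-trans (k1' (s≤s z≤n)) (m≤n+m k' s')) (1≤+-transport r1' rj)) ,
      ≤-trans (m<m+n s' (k1' (s≤s z≤n))) (≤-reflexive (sym (+-identityʳ _))) ,
      (refl , ≈-⊓ M τ≤M (≈-+ rr (weaken gg)) , inj₁ (inDescent (suc w1x) k' refl refl (s≤s z≤n) (k1' (s≤s z≤n)) (weaken ss) kk))
    similarWindow-prefix {s = s} {t' = shape m' g' j'} {s' = s'} (refl , gg , inj₁ (inDescent w w' refl refl w1 w1' ss ww)) (prefix-zeros _ g i d mi d1) s<l =
      shape (s' + w') g' i , prefix-zeros (s' + w') g' i d (≤-trans (≤-trans w1' (m≤n+m w' s')) (m≤m+n _ i)) d1 ,
      ≤-trans (m<m+n s' w1') (m≤m+n _ i) ,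
      (refl , weaken gg , inj₁ (inDescent w w' refl refl w1 w1' (weaken ss) (weaken ww)))
    similarWindow-prefix {s = s} {t' = shape m' g' j'} {s' = s'} (refl , gg , inj₂ (inZeros b refl refl mm)) (prefix-descent k r g j k1 rj) s<l =
      ⊥-elim (<-irrefl refl (≤-trans s<l (≤-trans (≤-reflexive (+-identityʳ k)) (≤-trans (m≤m+n k r) (m≤m+n (k + r) b)))))
    similarWindow-prefix {s = s} {t' = shape m' g' j'} {s' = s'} (refl , gg , inj₂ (inZeros b refl refl mm)) (prefix-zeros m g i d mi d1) s<l
      with <⇒≡+suc (+-cancelˡ-< m b i s<l)
    ... | e , refl =
      shape m' g' (b + suc e) , prefix-zeros m' g' (b + suc e) d (≤-trans (s≤s z≤n) (≤-trans (≤-reflexive (sym (+-suc b e))) (m≤n+m _ m'))) d1 ,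
      +-monoʳ-< m' (m<m+n b (s≤s z≤n)) ,
      (refl , weaken gg , inj₂ (inZeros b refl refl (weaken mm)))

    -- In the descent case the window game reduces to the shape game on the part of the
    -- descent after the offset.
    similarWindow-rightExt : ∀ {t s t' s' t''} → SimilarWindows (suc h) t s t' s' → WellFormed t → WellFormed t' → WellFormed t'' →
                             s < size t → PrefixShape t'' t →
                             Σ Shape λ t''' → WellFormed t''' × PrefixShape t''' t' × SimilarWindows h t'' s t''' s'
    similarWindow-rightExt {shape m g j} {s} {shape m' g' j'} {s'} {t''} (refl , gg , inj₁ (inDescent w w' ew refl w1 w1' ss ww)) v v' v'' s<l pt
      with unshift pt ew w1
    ... | unshifted a ea pa a1
      with similar-rightExt (refl , ww , gg)
             (wf⁺ w1' (1≤g v') (g≤M v') (λ j1 → zeros⇒g≡1 v' j1 (≤-trans w1' (m≤n+m w' s'))))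
             (wf⁺ a1 (1≤g v'') (g≤M v'') (λ j1 → zeros⇒g≡1 v'' j1 (≤-trans a1 (≤-trans (m≤n+m a s) (≤-reflexive (sym ea))))))
             pa
    ...   | t3 , v3 , pt3 , (j3 , m3 , g3) =
      shape (s' + Shape.m t3) (Shape.g t3) (Shape.j t3) ,
      wf⁺ (≤-trans 1≤m3 (m≤n+m _ s')) (1≤g v3) (g≤M v3) (λ j1 → zeros⇒g≡1 v3 j1 1≤m3) ,
      PrefixShape-shift s' pt3 ,
      (j3 , g3 , inj₁ (inDescent a (Shape.m t3) ea refl a1 1≤m3 (weaken ss) m3))
      where
      1≤m3 : 1 ≤ Shape.m t3
      1≤m3 = ≈-positive 1≤τ a1 m3
    similarWindow-rightExt {shape m g j} {s} {shape m' g' j'} {s'} {t''} (refl , gg , inj₂ (inZeros b refl refl mm)) v v' v'' s<l (prefix-descent k r g0 j0 k1 rj) =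
      ⊥-elim (<-irrefl refl (≤-trans s<l (≤-trans (≤-reflexive (+-identityʳ k)) (m≤m+n k b))))
    similarWindow-rightExt {shape m g j} {s} {shape m' g' j'} {s'} {t''} (refl , gg , inj₂ (inZeros b refl refl mm)) v v' v'' s<l (prefix-zeros m0 g0 i d mi d1) =
      shape m' g' (i + d) ,
      wf (1≤g v') (g≤M v') (≤-trans i1 (≤-trans (m≤m+n i d) (m≤n+m _ m')))
         (λ j1 m1 → ≈-1 (2≤threshold (suc h)) gg (zeros⇒g≡1 v i1 (≈-positive 1≤τ⁺ m1 (≈-sym mm))))
         (m≡0⇒g≡1 v') ,
      prefix-zeros m' g' i d (≤-trans i1 (m≤n+m i m')) d1 ,
      (refl , weaken gg , inj₂ (inZeros b refl refl (weaken mm)))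
      where
      i1 : 1 ≤ i
      i1 = ≤-trans (s≤s z≤n) (+-cancelˡ-< m b i s<l)

fromℕ-clamped : ∀ M → ℕ → Fin (suc M)
fromℕ-clamped M zero = F.zero
fromℕ-clamped zero (suc x) = F.zero
fromℕ-clamped (suc M) (suc x) = F.suc (fromℕ-clamped M x)

toℕ-fromℕ-clamped : ∀ M x → x ≤ M → toℕ (fromℕ-clamped M x) ≡ x
toℕ-fromℕ-clamped M zero _ = refl
toℕ-fromℕ-clamped (suc M) (suc x) (s≤s x≤M) = cong suc (toℕ-fromℕ-clamped M x x≤M)

module LadderTraces (M : ℕ) (1≤M : 1 ≤ M) where
  open LadderWords M 1≤M

  State : Set
  State = Fin (suc M)

  heights : List⁺ State → List ℕ
  heights ρ = L.map toℕ (toList ρ)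

  heights-++ : ∀ ρ σ → heights (ρ ⁺++⁺ σ) ≡ heights ρ ++ heights σ
  heights-++ ρ σ = map-++ toℕ (toList ρ) (toList σ)

  length-heights : ∀ ρ → length (heights ρ) ≡ length (toList ρ)
  length-heights ρ = length-map toℕ (toList ρ)

  heights≤M : ∀ (xs : List State) → All (_≤ M) (L.map toℕ xs)
  heights≤M [] = []
  heights≤M (x ∷ xs) = toℕ≤pred[n] x ∷ heights≤M xs

  map-toℕ-fromℕ-clamped : ∀ xs → All (_≤ M) xs → L.map toℕ (L.map (fromℕ-clamped M) xs) ≡ xs
  map-toℕ-fromℕ-clamped [] [] = refl
  map-toℕ-fromℕ-clamped (x ∷ xs) (p ∷ ps) = cong₂ _∷_ (toℕ-fromℕ-clamped M x p) (map-toℕ-fromℕ-clamped xs ps)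

  realise : ∀ xs → 1 ≤ length xs → All (_≤ M) xs → Σ (List⁺ State) λ σ → heights σ ≡ xs
  realise xs 1≤len xs≤M with nonEmpty⇒List⁺ xs 1≤len
  ... | l , refl = N.map (fromℕ-clamped M) l , map-toℕ-fromℕ-clamped (toList l) xs≤M

  length-word-heights : ∀ ρ t → heights ρ ≡ word t → length (toList ρ) ≡ size t
  length-word-heights ρ t e = trans (sym (length-heights ρ)) (trans (cong length e) (length-word t))

  size-++ : ∀ t t1 rest → word t ≡ word t1 ++ rest → size t ≡ size t1 + length rest
  size-++ t t1 rest e = trans (sym (length-word t)) (trans (cong length e) (trans (length-++ (word t1)) (cong (_+ length rest) (length-word t1))))

  ++-size : ∀ t t1 rest → word t ≡ rest ++ word t1 → size t ≡ length rest + size t1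
  ++-size t t1 rest e = trans (sym (length-word t)) (trans (cong length e) (trans (length-++ rest) (cong (length rest +_) (length-word t1))))

  size-prefix< : ∀ {t'' t} → PrefixShape t'' t → size t < size t''
  size-prefix< {t''} {t} pt with word-prefix pt
  ... | rest , 1≤rest , w = ≤-trans (m<m+n (size t) 1≤rest) (≤-reflexive (sym (size-++ t'' t rest w)))

  length⁺-++< : ∀ ρ1 ρ2 t → heights (ρ1 ⁺++⁺ ρ2) ≡ word t → length (toList ρ1) < size t
  length⁺-++< ρ1 ρ2 t e =
    ≤-trans (m<m+n _ (1≤length⁺ ρ2)) (≤-reflexive (trans (sym (length-++ (toList ρ1))) (length-word-heights (ρ1 ⁺++⁺ ρ2) t e)))

  decodeTrace : ∀ (ρ : List⁺ State) → Linked Step (heights ρ) → Σ Shape λ t → WellFormed t × heights ρ ≡ word t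
  decodeTrace (x ∷ xs) lk = decode (toℕ x) (L.map toℕ xs) (heights≤M (x ∷ xs)) lk

  word⇒Linked : ∀ σ t → heights σ ≡ word t → WellFormed t → Linked (λ a b → Step (toℕ a) (toℕ b)) (toList σ)
  word⇒Linked σ t e v = map⁻ (subst (Linked Step) (sym e) (Linked-word t v))

  prefix-split : ∀ {Q t Q1 Q2} → heights Q ≡ word t → WellFormed t → Q ≡ Q1 ⁺++⁺ Q2 →
                 Σ Shape λ t1 → PrefixShape t t1 × (heights Q1 ≡ word t1) × (length (toList Q1) ≡ size t1)
  prefix-split {Q} {t} {Q1} {Q2} e v refl with prefixShape-of-length t v (length (toList Q1)) (1≤length⁺ Q1) (length⁺-++< Q1 Q2 t e)
  ... | t1 , pt , size≡ with word-prefix pt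
  ... | rest , _ , w = t1 , pt ,
        proj₁ (++-injective (heights Q1) (heights Q2) (word t1) rest (trans (trans (sym (heights-++ Q1 Q2)) e) w)
                            (trans (length-heights Q1) (sym (trans (length-word t1) size≡)))) ,
        sym size≡

  suffix-split : ∀ {Q t Q2 Q1} → heights Q ≡ word t → WellFormed t → Q ≡ Q2 ⁺++⁺ Q1 →
                 Σ Shape λ t1 → SuffixShape t t1 × (heights Q1 ≡ word t1)
  suffix-split {Q} {t} {Q2} {Q1} e v refl with suffixShape-of-length t v (length (toList Q2)) (1≤length⁺ Q2) (length⁺-++< Q2 Q1 t e)
  ... | t1 , pt , size≡ with word-suffix pt
  ... | rest , _ , w = t1 , pt ,
        proj₂ (++-injective (heights Q2) (heights Q1) rest (word t1) (trans (trans (sym (heights-++ Q2 Q1)) e) w)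
                            (trans (length-heights Q2) (+-cancelʳ-≡ (size t1) _ (length rest) (trans size≡ (++-size t t1 rest w)))))

  prefix-realise : ∀ {Q' t' t1'} → heights Q' ≡ word t' → WellFormed t' → PrefixShape t' t1' →
                   Σ (List⁺ State) λ Q1' → Σ (List⁺ State) λ Q2' →
                     (Q' ≡ Q1' ⁺++⁺ Q2') × (heights Q1' ≡ word t1') × (length (toList Q1') ≡ size t1')
  prefix-realise {Q'} {t'} {t1'} e' v' pt' with word-prefix pt'
  ... | rest , 1≤rest , w
    with splitAt⁺ Q' (size t1') (1≤size (wf-prefix v' pt'))
                  (≤-trans (m<m+n (size t1') 1≤rest) (≤-reflexive (sym (trans (length-word-heights Q' t' e') (size-++ t' t1' rest w)))))
  ... | Q1' , Q2' , refl , length≡ = Q1' , Q2' , refl ,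
        proj₁ (++-injective (heights Q1') (heights Q2') (word t1') rest (trans (sym (heights-++ Q1' Q2')) (trans e' w))
                            (trans (length-heights Q1') (trans length≡ (sym (length-word t1'))))) ,
        length≡

  suffix-realise : ∀ {Q' t' t1'} → heights Q' ≡ word t' → WellFormed t' → SuffixShape t' t1' →
                   Σ (List⁺ State) λ Q2' → Σ (List⁺ State) λ Q1' → (Q' ≡ Q2' ⁺++⁺ Q1') × (heights Q1' ≡ word t1')
  suffix-realise {Q'} {t'} {t1'} e' v' pt' with word-suffix pt'
  ... | rest , 1≤rest , w
    with splitAt⁺ Q' (length rest) 1≤rest
                  (≤-trans (m<m+n (length rest) (1≤size (wf-suffix v' pt'))) (≤-reflexive (sym (trans (length-word-heights Q' t' e') (++-size t' t1' rest w)))))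
  ... | Q2' , Q1' , refl , length≡ = Q2' , Q1' , refl ,
        proj₂ (++-injective (heights Q2') (heights Q1') rest (word t1') (trans (sym (heights-++ Q2' Q1')) (trans e' w))
                            (trans (length-heights Q2') length≡))

  rightExt-decode : ∀ {Q t Q''} → heights Q ≡ word t → WellFormed t → Linked Step (heights (Q ⁺++⁺ Q'')) →
                    Σ Shape λ t'' → WellFormed t'' × PrefixShape t'' t × (heights (Q ⁺++⁺ Q'') ≡ word t'')
  rightExt-decode {Q} {t} {Q''} e v lk with decodeTrace (Q ⁺++⁺ Q'') lk
  ... | t'' , v'' , e'' with prefix-split e'' v'' refl
  ... | t1 , pt , e1 , _ with word-injective v (wf-prefix v'' pt) (trans (sym e) e1)
  ... | refl = t'' , v'' , pt , e''

  leftExt-decode : ∀ {Q t Q''} → heights Q ≡ word t → WellFormed t → Linked Step (heights (Q'' ⁺++⁺ Q)) →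
                   Σ Shape λ t'' → WellFormed t'' × SuffixShape t'' t × (heights (Q'' ⁺++⁺ Q) ≡ word t'')
  leftExt-decode {Q} {t} {Q''} e v lk with decodeTrace (Q'' ⁺++⁺ Q) lk
  ... | t'' , v'' , e'' with suffix-split e'' v'' refl
  ... | t1 , pt , e1 with word-injective v (wf-suffix v'' pt) (trans (sym e) e1)
  ... | refl = t'' , v'' , pt , e''

  rightExt-realise : ∀ {Q' t' t3} → heights Q' ≡ word t' → PrefixShape t3 t' →
                     Σ (List⁺ State) λ Q'' → heights (Q' ⁺++⁺ Q'') ≡ word t3
  rightExt-realise {Q'} {t'} {t3} e' pt3 with word-prefix pt3
  ... | rest , 1≤rest , w with realise rest 1≤rest (AP.++⁻ʳ (word t') (subst (All (_≤ M)) w (word≤M t3)))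
  ... | Q'' , e'' = Q'' , trans (heights-++ Q' Q'') (trans (cong₂ _++_ e' e'') (sym w))

  leftExt-realise : ∀ {Q' t' t3} → heights Q' ≡ word t' → SuffixShape t3 t' →
                    Σ (List⁺ State) λ Q'' → heights (Q'' ⁺++⁺ Q') ≡ word t3
  leftExt-realise {Q'} {t'} {t3} e' pt3 with word-suffix pt3
  ... | rest , 1≤rest , w with realise rest 1≤rest (AP.++⁻ˡ rest (subst (All (_≤ M)) w (word≤M t3)))
  ... | Q'' , e'' = Q'' , trans (heights-++ Q'' Q') (trans (cong₂ _++_ e'' e') (sym w))

module Ladder (n : ℕ) (M : ℕ) (1≤M : 1 ≤ M) where
  open LadderWords M 1≤M
  open ShapeGames M 1≤M
  open LadderTraces M 1≤M

  label : State → Subset n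
  label F.zero = Subset.⊤
  label (F.suc _) = Subset.⊥

  ladder : State → Kripke n State
  ladder s = record { δ = λ a b → Step (toℕ a) (toℕ b) ; μ = label ; s₀ = s }

  traces windows : State → IntervalStructure n
  traces s = traceStructure (ladder s)
  windows s = ComputationTree.windowStructure (ladder s)

  All-label⇔zeros : ∀ q (xs : List State) → All (λ s → q ∈ label s) xs ⇔ All (_≡ 0) (L.map toℕ xs)
  All-label⇔zeros q [] = mk⇔ (λ _ → []) (λ _ → [])
  All-label⇔zeros q (F.zero ∷ xs) =
    mk⇔ (λ { (_ ∷ ps) → refl ∷ to (All-label⇔zeros q xs) ps }) (λ { (_ ∷ ps) → ∈⊤ ∷ from (All-label⇔zeros q xs) ps })
  All-label⇔zeros q (F.suc x ∷ xs) = mk⇔ (λ { (p ∷ _) → ⊥-elim (∉⊥ p) }) (λ { (() ∷ _) })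

  ¬All-zeros-drop-descent : ∀ m g z s → 1 ≤ g → s < m → ¬ All (_≡ 0) (drop s (descent m g ++ z))
  ¬All-zeros-drop-descent (suc m) g z zero 1≤g _ (p ∷ _) = 1+n≰n (≤-trans (1≤M⊓ (≤-trans 1≤g (m≤n+m g m))) (≤-reflexive p))
  ¬All-zeros-drop-descent (suc m) g z (suc s) 1≤g (s≤s s<m) = ¬All-zeros-drop-descent m g z s 1≤g s<m

  All-zeros-drop-word : ∀ m g j s → m ≤ s → All (_≡ 0) (drop s (word (shape m g j)))
  All-zeros-drop-word zero g j s _ = AP.drop⁺ s (AP.replicate⁺ j refl)
  All-zeros-drop-word (suc m) g j (suc s) (s≤s m≤s) = All-zeros-drop-word m g j s m≤s

  All-zeros-drop-word⇔ : ∀ t → WellFormed t → ∀ s → All (_≡ 0) (drop s (word t)) ⇔ (m t ≤ s)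
  All-zeros-drop-word⇔ (shape m g j) v s with m ≤? s
  ... | yes m≤s = mk⇔ (λ _ → m≤s) (λ _ → All-zeros-drop-word m g j s m≤s)
  ... | no m≰s = mk⇔ (λ a → ⊥-elim (¬All-zeros-drop-descent m g _ s (1≤g v) (≰⇒> m≰s) a)) (λ m≤s → ⊥-elim (m≰s m≤s))

  Holds-drop⇔ : ∀ q Q s → All (λ x → q ∈ label x) (drop s (toList Q)) ⇔ All (_≡ 0) (drop s (heights Q))
  Holds-drop⇔ q Q s = mk⇔ (λ a → subst (All (_≡ 0)) (sym (drop-map s (toList Q))) (to (All-label⇔zeros q _) a))
                          (λ a → from (All-label⇔zeros q _) (subst (All (_≡ 0)) (drop-map s (toList Q)) a))

  SimilarTraces : ℕ → List⁺ State → List⁺ State → Set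
  SimilarTraces h ρ σ = (threshold h ≤ M) × Σ Shape λ t → Σ Shape λ t' →
    WellFormed t × WellFormed t' × (heights ρ ≡ word t) × (heights σ ≡ word t') × SimilarShapes h t t'

  SimilarWindowTraces : ℕ → List⁺ State × ℕ → List⁺ State × ℕ → Set
  SimilarWindowTraces h (Q , s) (Q' , s') = (threshold h ≤ M) × Σ Shape λ t → Σ Shape λ t' →
    WellFormed t × WellFormed t' × (heights Q ≡ word t) × (heights Q' ≡ word t') ×
    (s < size t) × (s' < size t') × SimilarWindows h t s t' s'

  SimilarTraces-sym : ∀ {h ρ σ} → SimilarTraces h ρ σ → SimilarTraces h σ ρ
  SimilarTraces-sym {h} (hM , t , t' , v , v' , e , e' , r) = hM , t' , t , v' , v , e' , e , SimilarShapes-sym {h} r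

  SimilarWindowTraces-sym : ∀ {h τ τ'} → SimilarWindowTraces h τ τ' → SimilarWindowTraces h τ' τ
  SimilarWindowTraces-sym {h} (hM , t , t' , v , v' , e , e' , l , l' , c) = hM , t' , t , v' , v , e' , e , l' , l , SimilarWindows-sym {h} c

  private
    threshold-pred≤ : ∀ {h} → threshold (suc h) ≤ M → threshold h ≤ M
    threshold-pred≤ {h} = ≤-trans (m≤m+n (threshold h) (threshold h))

  module _ {a b : State} where

    holds-similar : ∀ {h ρ σ} → SimilarTraces h ρ σ → ∀ q → Holds (traces a) q ρ → Holds (traces b) q σ
    holds-similar {h} {ρ} {σ} (_ , t , t' , v , v' , e , e' , (_ , m≈ , _)) q holds =
      from (All-label⇔zeros q (toList σ)) (subst (All (_≡ 0)) (sym e') (All-zeros-drop-word (m t') (g t') (j t') 0 (≤-reflexive m'≡0)))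
      where
      m≡0 : m t ≡ 0
      m≡0 = n≤0⇒n≡0 (to (All-zeros-drop-word⇔ t v 0) (subst (All (_≡ 0)) e (to (All-label⇔zeros q (toList ρ)) holds)))
      m'≡0 : m t' ≡ 0
      m'≡0 = trans (sym (≈-small (subst (_< threshold h) (sym m≡0) (≤-trans (s≤s z≤n) (2≤threshold h))) m≈)) m≡0

    prefix-forth : ∀ {h} → Forth (traces a) (traces b) (Prefix (traces a)) (Prefix (traces b)) (SimilarTraces (suc h)) (SimilarTraces h)
    prefix-forth {h} (hM , t , t' , v , v' , e , e' , r) (ρ2 , eq) =
      let t1 , pt , e1 , _ = prefix-split e v eq
          t1' , pt' , r1 = similar-prefix h hM r pt
          σ1 , σ2 , eσ , e1' , _ = prefix-realise e' v' pt'
      in σ1 , (σ2 , eσ) , (threshold-pred≤ {h} hM , t1 , t1' , wf-prefix v pt , wf-prefix v' pt' , e1 , e1' , r1)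

    suffix-forth : ∀ {h} → Forth (traces a) (traces b) (Suffix (traces a)) (Suffix (traces b)) (SimilarTraces (suc h)) (SimilarTraces h)
    suffix-forth {h} (hM , t , t' , v , v' , e , e' , r) (ρ2 , eq) =
      let t1 , pt , e1 = suffix-split e v eq
          t1' , pt' , r1 = similar-suffix h hM r pt
          σ2 , σ1 , eσ , e1' = suffix-realise e' v' pt'
      in σ1 , (σ2 , eσ) , (threshold-pred≤ {h} hM , t1 , t1' , wf-suffix v pt , wf-suffix v' pt' , e1 , e1' , r1)

    rightExt-forth : ∀ {h} → Forth (traces a) (traces b) (RightExt (traces a)) (RightExt (traces b)) (SimilarTraces (suc h)) (SimilarTraces h)
    rightExt-forth {h} {ρ} {σ} (hM , t , t' , v , v' , e , e' , r) (ρ'' , tr , refl) =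
      let t'' , v'' , pt , e'' = rightExt-decode {Q'' = ρ''} e v (map⁺ tr)
          t3 , v3 , pt3 , r3 = similar-rightExt h hM r v' v'' pt
          σ'' , eσ = rightExt-realise e' pt3
      in σ ⁺++⁺ σ'' , (σ'' , word⇒Linked (σ ⁺++⁺ σ'') t3 eσ v3 , refl) , (threshold-pred≤ {h} hM , t'' , t3 , v'' , v3 , e'' , eσ , r3)

    leftExt-forth : ∀ {h} → Forth (traces a) (traces b) (LeftExt (traces a)) (LeftExt (traces b)) (SimilarTraces (suc h)) (SimilarTraces h)
    leftExt-forth {h} {ρ} {σ} (hM , t , t' , v , v' , e , e' , r) (ρ'' , tr , refl) =
      let t'' , v'' , pt , e'' = leftExt-decode {Q'' = ρ''} e v (map⁺ tr)
          t3 , v3 , pt3 , r3 = similar-leftExt h hM r v' v'' pt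
          σ'' , eσ = leftExt-realise e' pt3
      in σ'' ⁺++⁺ σ , (σ'' , word⇒Linked (σ'' ⁺++⁺ σ) t3 eσ v3 , refl) , (threshold-pred≤ {h} hM , t'' , t3 , v'' , v3 , e'' , eσ , r3)

    holds-similarWindow : ∀ {h τ τ'} → SimilarWindowTraces h τ τ' → ∀ q → Holds (windows a) q τ → Holds (windows b) q τ'
    holds-similarWindow {h} {Q , s} {Q' , s'} (_ , t , t' , v , v' , e , e' , _ , _ , (_ , _ , c)) q holds =
      from (Holds-drop⇔ q Q' s') (subst (λ z → All (_≡ 0) (drop s' z)) (sym e') (zeros-after c))
      where
      zeros-from-s : All (_≡ 0) (drop s (word t))
      zeros-from-s = subst (λ z → All (_≡ 0) (drop s z)) e (to (Holds-drop⇔ q Q s) holds)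
      zeros-after : InDescent (threshold h) t s t' s' ⊎ InZeros (threshold h) t s t' s' → All (_≡ 0) (drop s' (word t'))
      zeros-after (inj₁ (inDescent w _ m≡s+w _ 1≤w _ _ _)) =
        ⊥-elim (<-irrefl refl (≤-trans (m<m+n s 1≤w) (≤-trans (≤-reflexive (sym m≡s+w)) (to (All-zeros-drop-word⇔ t v s) zeros-from-s))))
      zeros-after (inj₂ (inZeros b _ s'≡m'+b _)) = from (All-zeros-drop-word⇔ t' v' s') (≤-trans (m≤m+n _ b) (≤-reflexive (sym s'≡m'+b)))

    windowPrefix-forth : ∀ {h} → Forth (windows a) (windows b) (Prefix (windows a)) (Prefix (windows b)) (SimilarWindowTraces (suc h)) (SimilarWindowTraces h)
    windowPrefix-forth {h} {Q , s} {Q' , s'} {Q1 , .s} (hM , t , t' , v , v' , e , e' , l , l' , c) (refl , (Q2 , eQ) , lt) =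
      let t1 , pt , e1 , l1 = prefix-split {Q1 = Q1} {Q2} e v eQ
          s<size₁ = ≤-trans lt (≤-reflexive l1)
          t1' , pt' , lt' , c1 = similarWindow-prefix h hM c pt s<size₁
          Q1' , Q2' , eσ , e1' , l1' = prefix-realise e' v' pt'
      in (Q1' , s') , (refl , (Q2' , eσ) , ≤-trans lt' (≤-reflexive (sym l1'))) ,
         (threshold-pred≤ {h} hM , t1 , t1' , wf-prefix v pt , wf-prefix v' pt' , e1 , e1' , s<size₁ , lt' , c1)

    windowSuffix-forth : ∀ {h} → Forth (windows a) (windows b) (Suffix (windows a)) (Suffix (windows b)) (SimilarWindowTraces (suc h)) (SimilarWindowTraces h)
    windowSuffix-forth {h} {Q , s} {Q' , s'} {.Q , s1} (hM , t , t' , v , v' , e , e' , l , l' , c) (refl , s<s1 , s1<) =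
      let s1<size = ≤-trans s1< (≤-reflexive (length-word-heights Q t e))
          s1' , s'<s1' , s1'<size , c1 = similarWindow-suffix h hM c s<s1 s1<size
      in (Q' , s1') , (refl , s'<s1' , ≤-trans s1'<size (≤-reflexive (sym (length-word-heights Q' t' e')))) ,
         (threshold-pred≤ {h} hM , t , t' , v , v' , e , e' , s1<size , s1'<size , c1)

    windowRightExt-forth : ∀ {h} → Forth (windows a) (windows b) (RightExt (windows a)) (RightExt (windows b)) (SimilarWindowTraces (suc h)) (SimilarWindowTraces h)
    windowRightExt-forth {h} {Q , s} {Q' , s'} {.(Q ⁺++⁺ Q'') , .s} (hM , t , t' , v , v' , e , e' , l , l' , c) (refl , Q'' , tr , refl) =
      let t'' , v'' , pt , e'' = rightExt-decode {Q'' = Q''} e v (map⁺ tr)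
          t3 , v3 , pt3 , c3 = similarWindow-rightExt h hM c v v' v'' l pt
          Q3 , e3 = rightExt-realise e' pt3
      in (Q' ⁺++⁺ Q3 , s') , (refl , Q3 , word⇒Linked (Q' ⁺++⁺ Q3) t3 e3 v3 , refl) ,
         (threshold-pred≤ {h} hM , t'' , t3 , v'' , v3 , e'' , e3 , <-trans l (size-prefix< pt) , <-trans l' (size-prefix< pt3) , c3)

    windowLeftExt-forth : ∀ {h} → Forth (windows a) (windows b) (LeftExt (windows a)) (LeftExt (windows b)) (SimilarWindowTraces (suc h)) (SimilarWindowTraces h)
    windowLeftExt-forth {h} {Q , s} {Q' , s'} {.Q , s1} (hM , t , t' , v , v' , e , e' , l , l' , c) (refl , s1<s) =
      let s1' , s1'<s' , c1 = similarWindow-leftExt h hM c s1<s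
      in (Q' , s1') , (refl , s1'<s') , (threshold-pred≤ {h} hM , t , t' , v , v' , e , e' , <-trans s1<s l , <-trans s1'<s' l' , c1)

  traces-bisimulation : ∀ a b → GradedBisimulation (traces a) (traces b)
  traces-bisimulation = symmetricBisimulation traces (λ {_} {_} → SimilarTraces) (λ {_} {_} {h} → SimilarTraces-sym {h})
    (λ {a} {b} {h} → holds-similar {a} {b} {h})
    (λ {a} {b} {h} → prefix-forth {a} {b} {h}) (λ {a} {b} {h} → suffix-forth {a} {b} {h})
    (λ {a} {b} {h} → rightExt-forth {a} {b} {h}) (λ {a} {b} {h} → leftExt-forth {a} {b} {h})

  windows-bisimulation : ∀ a b → GradedBisimulation (windows a) (windows b)
  windows-bisimulation = symmetricBisimulation windows (λ {_} {_} → SimilarWindowTraces) (λ {_} {_} {h} → SimilarWindowTraces-sym {h})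
    (λ {a} {b} {h} → holds-similarWindow {a} {b} {h})
    (λ {a} {b} {h} → windowPrefix-forth {a} {b} {h}) (λ {a} {b} {h} → windowSuffix-forth {a} {b} {h})
    (λ {a} {b} {h} → windowRightExt-forth {a} {b} {h}) (λ {a} {b} {h} → windowLeftExt-forth {a} {b} {h})

headOr0 : List ℕ → ℕ
headOr0 [] = 0
headOr0 (x ∷ _) = x

module Counterexample (n : ℕ) (p : Fin n) (h : ℕ) where
  T : ℕ
  T = threshold h
  M₁ : ℕ
  M₁ = T + T
  M : ℕ
  M = suc M₁

  1≤M : 1 ≤ M
  1≤M = s≤s z≤n

  open LadderWords M 1≤M
  open ShapeGames M 1≤M
  open LadderTraces M 1≤M
  open Ladder n M 1≤M

  private
    T≤M₁ : T ≤ M₁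
    T≤M₁ = m≤m+n T T
    M₁≤M : M₁ ≤ M
    M₁≤M = n≤1+n M₁
    1≤T : 1 ≤ T
    1≤T = ≤-trans (s≤s z≤n) (2≤threshold h)

  top below : State
  top = fromℕ-clamped M M
  below = fromℕ-clamped M M₁

  ladder-leftTotal : ∀ s → LeftTotal (ladder s)
  ladder-leftTotal s F.zero = F.zero , inj₂ (refl , inj₁ refl)
  ladder-leftTotal s (F.suc a) = F.inject₁ a , inj₁ (cong suc (toℕ-inject₁ a))

  top⊭Fp : ¬ (ladder top ⊨F p)
  top⊭Fp top⊨Fp with top⊨Fp (λ _ → top) (refl , λ i → inj₂ (refl , inj₂ (toℕ-fromℕ-clamped M M ≤-refl)))
  ... | _ , p∈⊥ = ∉⊥ p∈⊥

  -- Below the top there is no loop until 0, so after i ≤ M₁ steps every path is at height M₁ − i.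
  below⊨Fp : ladder below ⊨F p
  below⊨Fp π (π0 , steps) = M₁ , at0 (π M₁) (+-cancelʳ-≡ M₁ _ 0 (height+i≡M₁ M₁ ≤-refl))
    where
    at0 : ∀ (x : State) → toℕ x ≡ 0 → p ∈ label x
    at0 F.zero _ = ∈⊤
    height+i≡M₁ : ∀ i → i ≤ M₁ → toℕ (π i) + i ≡ M₁
    height+i≡M₁ zero _ = trans (+-identityʳ _) (trans (cong toℕ π0) (toℕ-fromℕ-clamped M M₁ M₁≤M))
    height+i≡M₁ (suc i) i<M₁ with height+i≡M₁ i (≤-trans (n≤1+n i) i<M₁) | steps i
    ... | ih | inj₁ e = trans (+-suc _ i) (trans (cong (_+ i) e) ih)
    ... | ih | inj₂ (e , inj₁ x≡0) = ⊥-elim (<-irrefl (sym (trans (sym ih) (cong (_+ i) x≡0))) i<M₁)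
    ... | ih | inj₂ (e , inj₂ x≡M) =
      ⊥-elim (<-irrefl refl (≤-trans (s≤s (m≤m+n M₁ i)) (≤-reflexive (trans (cong (_+ i) (sym x≡M)) ih))))

  record Match (t : Shape) : Set where
    constructor match
    field
      t' : Shape
      wf' : WellFormed t'
      head≡M₁ : headOr0 (word t') ≡ M₁
      similar : SimilarShapes h t' t

  -- A trace from the top is matched by one from below that descends the same way except that
  -- it starts one step lower; large descent lengths and floors are exchanged for other large ones.
  matchFromBelow : ∀ t → WellFormed t → headOr0 (word t) ≡ M → Match t
  matchFromBelow (shape zero g zero) v ()
  matchFromBelow (shape zero g (suc j)) v ()
  matchFromBelow (shape (suc m₀) g j) v head≡M with g <? T
  ... | yes g<T =
    match (shape (suc (M₁ ∸ g)) g j) (wf⁺ (s≤s z≤n) (1≤g v) (g≤M v) (λ j1 → zeros⇒g≡1 v j1 (s≤s z≤n)))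
          (trans (cong (M ⊓_) (m∸n+n≡m g≤M₁)) (m≥n⇒m⊓n≡n M₁≤M))
          (refl , ≈-large (≤-trans T≤M₁∸g (n≤1+n _)) (≤-trans T≤m₀ (n≤1+n m₀)) , ≈-refl)
    where
    g≤M₁ : g ≤ M₁
    g≤M₁ = ≤-trans (<⇒≤ g<T) T≤M₁
    T≤M₁∸g : T ≤ M₁ ∸ g
    T≤M₁∸g = +-cancelʳ-≤ g T (M₁ ∸ g) (≤-trans (+-monoʳ-≤ T (<⇒≤ g<T)) (≤-reflexive (sym (m∸n+n≡m g≤M₁))))
    T≤m₀ : T ≤ m₀
    T≤m₀ = large-summand T m₀ g (≤-trans M₁≤M (m⊓n≡m⇒m≤n head≡M)) g<T
  ... | no g≮T with large-floor⇒no-zeros v (s≤s z≤n) (≤-trans (2≤threshold h) (≮⇒≥ g≮T))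
  ...   | refl with m₀ <? T
  ...     | yes m₀<T =
    match (shape (suc m₀) (M₁ ∸ m₀) 0) (wf⁺ (s≤s z≤n) (≤-trans 1≤T T≤M₁∸m₀) (≤-trans (m∸n≤m M₁ m₀) M₁≤M) (λ ()))
          (trans (cong (M ⊓_) (m+[n∸m]≡n m₀≤M₁)) (m≥n⇒m⊓n≡n M₁≤M))
          (refl , ≈-refl , ≈-large T≤M₁∸m₀ (≮⇒≥ g≮T))
    where
    m₀≤M₁ : m₀ ≤ M₁
    m₀≤M₁ = ≤-trans (<⇒≤ m₀<T) T≤M₁
    T≤M₁∸m₀ : T ≤ M₁ ∸ m₀
    T≤M₁∸m₀ = +-cancelʳ-≤ m₀ T (M₁ ∸ m₀) (≤-trans (+-monoʳ-≤ T (<⇒≤ m₀<T)) (≤-reflexive (sym (m∸n+n≡m m₀≤M₁))))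
  ...     | no m₀≮T =
    match (shape (suc T) T 0) (wf⁺ (s≤s z≤n) 1≤T (≤-trans T≤M₁ M₁≤M) (λ ())) (m≥n⇒m⊓n≡n M₁≤M)
          (refl , ≈-large (n≤1+n T) (≤-trans (≮⇒≥ m₀≮T) (n≤1+n m₀)) , ≈-large ≤-refl (≮⇒≥ g≮T))

  head-word-top : ∀ {Q} t → IsInitialTrace (ladder top) Q → heights Q ≡ word t → headOr0 (word t) ≡ M
  head-word-top t (_ , hd) e = trans (cong headOr0 (sym e)) (trans (cong toℕ hd) (toℕ-fromℕ-clamped M M ≤-refl))

  1≤m-top : ∀ t → headOr0 (word t) ≡ M → 1 ≤ m t
  1≤m-top (shape zero g zero) ()
  1≤m-top (shape zero g (suc j)) ()
  1≤m-top (shape (suc m) g j) _ = s≤s z≤n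

  traceFromBelow : ∀ t → WellFormed t → headOr0 (word t) ≡ M₁ →
                   Σ (List⁺ State) λ σ → IsInitialTrace (ladder below) σ × heights σ ≡ word t
  traceFromBelow t v head≡M₁ with realise (word t) (≤-trans (1≤size v) (≤-reflexive (sym (length-word t)))) (word≤M t)
  ... | σ , e = σ , (word⇒Linked σ t e v , toℕ-injective (trans (cong headOr0 e) (trans head≡M₁ (sym (toℕ-fromℕ-clamped M M₁ M₁≤M))))) , e

  -- Offset 0 lies in the descent because traces from the top start with a positive height.
  InitialMatch : List⁺ State → Set
  InitialMatch Q = Σ (List⁺ State) λ Q' → IsInitialTrace (ladder below) Q' ×
                     SimilarTraces h Q' Q × SimilarWindowTraces h (Q' , 0) (Q , 0)

  matchInitialTrace : ∀ Q → IsInitialTrace (ladder top) Q → InitialMatch Q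
  matchInitialTrace Q initial@(tr , _) with decodeTrace Q (map⁺ tr)
  ... | t , v , e with head-word-top t initial e
  ... | head≡M with matchFromBelow t v head≡M
  ... | match t' v' head≡M₁ (j≡ , m≈ , g≈) with traceFromBelow t' v' head≡M₁
  ... | Q' , initial' , e' =
    Q' , initial' , (T≤M , t' , t , v' , v , e' , e , (j≡ , m≈ , g≈)) ,
    (T≤M , t' , t , v' , v , e' , e , 1≤size v' , 1≤size v ,
     (j≡ , g≈ , inj₁ (inDescent (m t') (m t) refl refl (≈-positive 1≤T 1≤m (≈-sym m≈)) 1≤m ≈-refl m≈)))
    where
    1≤m : 1 ≤ m t
    1≤m = 1≤m-top t head≡M
    T≤M : T ≤ M
    T≤M = ≤-trans T≤M₁ M₁≤M

  no-st-definition : (ψ : HS n) → modalDepth ψ ≤ h →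
                     ¬ ((m : ℕ) (K : Kripke n (Fin m)) → LeftTotal K → (K ⊨st ψ) ⇔ (K ⊨F p))
  no-st-definition ψ d defines = top⊭Fp (to (defines (suc M) (ladder top) (ladder-leftTotal top)) top⊨ψ)
    where
    below⊨ψ : ladder below ⊨st ψ
    below⊨ψ = from (defines (suc M) (ladder below) (ladder-leftTotal below)) below⊨Fp
    transfer : ∀ {Q} → InitialMatch Q → Sat (ladder top) Q ψ
    transfer (Q' , initial' , similar , _) =
      from (Sat⇔ISat (ladder top) ψ _)
           (to (Related⇒ISat⇔ (traces-bisimulation below top) ψ h d similar) (to (Sat⇔ISat (ladder below) ψ Q') (below⊨ψ Q' initial')))
    top⊨ψ : ladder top ⊨st ψ
    top⊨ψ Q initial = transfer (matchInitialTrace Q initial)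

  no-ct-definition : (ψ : HS n) → modalDepth ψ ≤ h →
                     ¬ ((m : ℕ) (K : Kripke n (Fin m)) → LeftTotal K → (K ⊨ct ψ) ⇔ (K ⊨F p))
  no-ct-definition ψ d defines = top⊭Fp (to (defines (suc M) (ladder top) (ladder-leftTotal top)) top⊨ψ)
    where
    below⊨ψ : ladder below ⊨ct ψ
    below⊨ψ = from (defines (suc M) (ladder below) (ladder-leftTotal below)) below⊨Fp
    transfer : ∀ {Q} → InitialMatch Q → ISat (windows top) (Q , 0) ψ
    transfer (Q' , initial' , _ , similar) =
      to (Related⇒ISat⇔ (windows-bisimulation below top) ψ h d similar)
         (to (ComputationTree.⊨ct⇔initialWindows (ladder below) ψ) below⊨ψ Q' initial')
    top⊨ψ : ladder top ⊨ct ψ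
    top⊨ψ = from (ComputationTree.⊨ct⇔initialWindows (ladder top) ψ) (λ Q initial → transfer (matchInitialTrace Q initial))

proposition41 : (n : ℕ) (p : Fin n) →
    (¬ Σ (HS n) (λ ψ → (m : ℕ) (K : Kripke n (Fin m)) → LeftTotal K → ((K ⊨st ψ) ⇔ (K ⊨F p))))
    × (¬ Σ (HS n) (λ ψ → (m : ℕ) (K : Kripke n (Fin m)) → LeftTotal K → ((K ⊨ct ψ) ⇔ (K ⊨F p))))
proposition41 n p =
  (λ (ψ , defines) → Counterexample.no-st-definition n p (modalDepth ψ) ψ ≤-refl defines) ,
  (λ (ψ , defines) → Counterexample.no-ct-definition n p (modalDepth ψ) ψ ≤-refl defines)
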